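{- Let $\mathbf{m}=(m_1,\dots,m_n)\in\mathbb{Z}_{\ge0}^n$, let $P=[0,m_1]\times\cdots\times[0,m_n]\subseteq\mathbb{R}^n$, and let $\mathcal{A}$ be a finite set of integral affinographic hyperplanes in $\mathbb{R}^n$. Let $\Phi$ be the integral gain graph of $\mathcal{A}$. Then the number of integer points in $P\setminus\bigcup\mathcal{A}$ equals $$\sum_{B\in\mathrm{Lat}^b\Phi}\mu(\emptyset,B)\prod_{W_k\in\pi(B)}\Big(1+\min_{v_i\in W_k}\big[m_i+\varphi(B_{v_it_k})\big]-g_k\Big)^+,$$ where for each $W_k\in\pi(B)$, $t_k$ is a top vertex of the component of $B$ with vertex set $W_k$, and $g_k$ is the maximum gain of a path in $B$ within $W_k$.
   Context: An integral affinographic hyperplane is a hyperplane $x_j=x_i+a$ with $i\ne j$ and $a\in\mathbb{Z}$. The integral gain graph $\Phi$ of $\mathcal{A}$ has vertices $v_1,\dots,v_n$ and, for each hyperplane $x_j=x_i+a$ in $\mathcal{A}$, an edge from $v_i$ to $v_j$ with gain $a$ (its gain in the direction $v_j\to v_i$ is $-a$); the gain of a path is the sum of its edge gains. An edge set is balanced if every circle (cycle) in it has gain $0$; then all paths $B_{vw}$ in $B$ from $v$ to $w$ have the same gain $\varphi(B_{vw})$. A balanced set $B$ is closed if it contains every edge $e$ that lies in a balanced circle contained in $B\cup\{e\}$. $\mathrm{Lat}^b\Phi$ is the set of closed balanced edge sets ordered by inclusion and $\mu$ is its Möbius function. $\pi(B)$ is the partition of $\{v_1,\dots,v_n\}$ into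 vertex sets of connected components of $(V,B)$ (isolated vertices included). A top vertex of a component of balanced $B$ is a vertex $t$ such that no path in that component ending at $t$ has negative gain. $x^+=\max(x,0)$. -}

module Defs where

open import Data.Nat using (ℕ; zero; suc)
open import Data.Integer using (ℤ; +_; _+_; _-_; _*_; -_; _⊔_; _⊓_; _≤_; _≟_; 0ℤ; 1ℤ)
open import Data.Fin using (Fin)
open import Data.Fin.Subset using (Subset; _∪_; ⁅_⁆) renaming (_∈_ to _∈ₛ_)
open import Data.List using (List; []; _∷_; map; concat; concatMap; upTo; length; filter; foldr; allFin)
open import Data.List.Relation.Unary.All using (All; all?)
open import Data.List.Relation.Unary.Unique.Propositional using (Unique)
open import Data.List.Relation.Binary.Permutation.Propositional using (_↭_)
open import Data.List.Membership.Propositional using (_∈_)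
open import Data.Vec using (Vec; lookup) renaming ([] to []ᵥ; _∷_ to _∷ᵥ_)
open import Data.Product using (Σ; _×_; _,_; proj₁; ∃; ∃-syntax)
open import Data.Sum using (_⊎_)
open import Relation.Binary.PropositionalEquality using (_≡_; _≢_)
open import Relation.Nullary using (¬_; ¬?)

-- Integral affinographic hyperplanes  x_tgt = x_src + gain  in R^n
-- (the hypothesis src ≢ tgt is imposed in the theorem).

record Hyp (n : ℕ) : Set where
  constructor hyp
  field
    src  : Fin n
    tgt  : Fin n
    gain : ℤ
open Hyp public

SameHyperplane : ∀ {n} → Hyp n → Hyp n → Set
SameHyperplane h h' =
  (src h ≡ src h' × tgt h ≡ tgt h' × gain h ≡ gain h')
  ⊎ (src h ≡ tgt h' × tgt h ≡ src h' × gain h ≡ - gain h')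

box : ∀ {n} → Vec ℕ n → List (Vec ℕ n)
box []ᵥ = []ᵥ ∷ []
box (k ∷ᵥ m) = concatMap (λ x → map (x ∷ᵥ_) (box m)) (upTo (suc k))

Avoids : ∀ {n} → List (Hyp n) → Vec ℕ n → Set
Avoids A x = All (λ h → + lookup x (tgt h) ≢ + lookup x (src h) + gain h) A

countPoints : ∀ {n} → Vec ℕ n → List (Hyp n) → ℕ
countPoints m A =
  length (filter (λ x → all? (λ h → ¬? (+ lookup x (tgt h) ≟ + lookup x (src h) + gain h)) A) (box m))

-- The integral gain graph Φ of A: vertices Fin n, edges Fin (length A);
-- edge e (hyperplane x_j = x_i + a) goes from v_i to v_j with gain a.

data Dir : Set where
  fwd bwd : Dir

module GainGraph {n : ℕ} (A : List (Hyp n)) where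

  E : ℕ
  E = length A

  edge : Fin E → Hyp n
  edge e = Data.List.lookup A e

  Dart : Set
  Dart = Fin E × Dir

  start : Dart → Fin n
  start (e , fwd) = src (edge e)
  start (e , bwd) = tgt (edge e)

  end : Dart → Fin n
  end (e , fwd) = tgt (edge e)
  end (e , bwd) = src (edge e)

  dgain : Dart → ℤ
  dgain (e , fwd) = gain (edge e)
  dgain (e , bwd) = - gain (edge e)

  data IsWalk : Fin n → List Dart → Fin n → Set where
    nil  : ∀ {u} → IsWalk u [] u
    cons : ∀ {u w d ds} → start d ≡ u → IsWalk (end d) ds w → IsWalk u (d ∷ ds) w

  walkGain : List Dart → ℤ
  walkGain ds = foldr (λ d s → dgain d + s) 0ℤ ds

  vertices : Fin n → List Dart → List (Fin n)
  vertices u ds = u ∷ map end ds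

  edgesOf : List Dart → List (Fin E)
  edgesOf ds = map proj₁ ds

  InSet : Subset E → List Dart → Set
  InSet B ds = All (λ e → e ∈ₛ B) (edgesOf ds)

  IsPath : Fin n → List Dart → Fin n → Set
  IsPath u ds w = IsWalk u ds w × Unique (vertices u ds)

  data NonEmpty {X : Set} : List X → Set where
    nonEmpty : ∀ {x xs} → NonEmpty (x ∷ xs)

  IsCircle : Fin n → List Dart → Set
  IsCircle u ds = IsWalk u ds u × NonEmpty ds × Unique (edgesOf ds) × Unique (map end ds)

  Balanced : Subset E → Set
  Balanced B = ∀ u ds → IsCircle u ds → InSet B ds → walkGain ds ≡ 0ℤ

  Closed : Subset E → Set
  Closed B = ∀ e →
    (∃[ u ] ∃[ ds ] (IsCircle u ds × InSet (B ∪ ⁅ e ⁆) ds × e ∈ edgesOf ds × walkGain ds ≡ 0ℤ))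
    → e ∈ₛ B

  -- A block of π(B) together with the data used in the formula:
  --   W   : vertex set of the component (a list),
  --   t   : a chosen top vertex of the component,
  --   g   : the maximum gain of a path in B within W,
  --   φ v : the gain φ(B_{v t}) of paths in B from v to t (for v ∈ W).
  record Block : Set where
    constructor block
    field
      W : List (Fin n)
      t : Fin n
      g : ℤ
      φ : Fin n → ℤ
  open Block public

  IsBlock : Subset E → Block → Set
  IsBlock B b =
    NonEmpty (W b)
    × (∀ v w → v ∈ W b → w ∈ W b → ∃[ ds ] (IsPath v ds w × InSet B ds))
    × (∀ v w ds → v ∈ W b → IsPath v ds w → InSet B ds → w ∈ W b)
    × t b ∈ W b
    × (∀ v ds → v ∈ W b → IsPath v ds (t b) → InSet B ds → 0ℤ ≤ walkGain ds)
    × (∃[ v ] ∃[ w ] ∃[ ds ] (v ∈ W b × IsPath v ds w × InSet B ds × walkGain ds ≡ g b))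
    × (∀ v w ds → v ∈ W b → IsPath v ds w → InSet B ds → walkGain ds ≤ g b)
    × (∀ v → v ∈ W b → ∃[ ds ] (IsPath v ds (t b) × InSet B ds × walkGain ds ≡ φ b v))

  -- the list of blocks is exactly π(B) (each vertex in exactly one block)
  IsPartitionData : Subset E → List Block → Set
  IsPartitionData B bs = concat (map W bs) ↭ allFin n × All (IsBlock B) bs

_⁺ : ℤ → ℤ
x ⁺ = x ⊔ 0ℤ

sumℤ : List ℤ → ℤ
sumℤ = foldr _+_ 0ℤ

prodℤ : List ℤ → ℤ
prodℤ = foldr _*_ 1ℤ

-- minimum of a nonempty list (value on [] is irrelevant: blocks are nonempty)
minℤ : List ℤ → ℤ
minℤ [] = 0ℤ
minℤ (x ∷ []) = x
minℤ (x ∷ y ∷ ys) = x ⊓ minℤ (y ∷ ys)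

blockFactor : ∀ {n} {A : List (Hyp n)} → Vec ℕ n → GainGraph.Block A → ℤ
blockFactor m b =
  (1ℤ + minℤ (map (λ v → + lookup m v + GainGraph.φ b v) (GainGraph.W b)) - GainGraph.g b) ⁺

-- For a point x of the box, the edges of Φ whose hyperplanes contain x form a set S(x).  Along
-- S(x) gains are differences of coordinates of x, so S(x) is balanced and closed, and x avoids
-- ⋃A iff S(x) = ∅.  Möbius inversion in Lat^b Φ writes the indicator of S(x) = ∅ as
-- Σ_{C ⊆ S(x)} μ(∅,C); exchanging the sums, the count is Σ_C μ(∅,C) times the number of box
-- points satisfying every edge of C.  On each block W_k of π(C) such a point is determined by
-- a = x_{t_k} through x_v = a − φ(B_{v t_k}), and these coordinates lie in range iff
-- g_k ≤ a ≤ min_v (m_v + φ(B_{v t_k})).  So each block contributes the factor (1 + min − g_k)^+,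
-- independently of the others.

module Submission where

open import Defs
open import Data.Nat using (ℕ)
open import Data.Integer using (ℤ; +_; _*_; 0ℤ; 1ℤ)
open import Data.Bool using (if_then_else_)
open import Data.Fin.Subset using (Subset; ⊥; _⊆_)
open import Data.Fin.Subset.Properties using (_⊆?_)
open import Data.List using (List; map; length)
open import Data.List.Relation.Unary.All using (All)
open import Data.List.Relation.Unary.AllPairs using (AllPairs)
open import Data.List.Relation.Unary.Unique.Propositional using (Unique)
open import Data.List.Membership.Propositional using (_∈_)
open import Data.Vec using (Vec)
open import Data.Product using (_×_)
open import Function.Bundles using (_⇔_)
open import Relation.Binary.PropositionalEquality using (_≡_; _≢_)
open import Relation.Nullary using (¬_)
open import Relation.Nullary.Decidable using (⌊_⌋)

import Data.Bool.Properties as Boolₚ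
open import Data.Empty using (⊥-elim)
open import Data.Fin using (Fin) renaming (zero to fzero; suc to fsuc)
import Data.Fin.Properties as Finₚ
open import Data.Fin.Subset using (_∪_; ⁅_⁆) renaming (_∈_ to _∈ₛ_)
import Data.Fin.Subset.Properties as Subsetₚ
open import Data.Integer as ℤ using (_+_; _-_; -_; _≤_; +≤+; +<+; -[1+_])
import Data.Integer.Properties as ℤₚ
open import Data.Integer.Tactic.RingSolver using (solve-∀)
open import Data.List using ([]; _∷_; _++_; concat; concatMap; filter; upTo; allFin)
import Data.List.Properties as Listₚ
open import Data.List.Membership.Propositional using (_∉_)
import Data.List.Membership.Propositional.Properties as ∈ₚ
open import Data.List.Relation.Binary.Permutation.Propositional
  using (_↭_; refl; prep; swap; trans; ↭-sym; ↭⇒↭ₛ)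
import Data.List.Relation.Binary.Permutation.Propositional.Properties as ↭ₚ
import Data.List.Relation.Binary.Permutation.Setoid.Properties as Setoid↭ₚ
open import Data.List.Relation.Unary.All as All using ([]; _∷_; all?)
import Data.List.Relation.Unary.All.Properties as Allₚ
open import Data.List.Relation.Unary.AllPairs using ([]; _∷_)
open import Data.List.Relation.Unary.Any as Any using (here; there)
import Data.List.Relation.Unary.Any.Properties as Anyₚ
import Data.List.Relation.Unary.Unique.Propositional.Properties as Uniqueₚ
open import Data.Nat as ℕ using (zero; suc; z≤n; s≤s)
import Data.Nat.Properties as ℕₚ
open import Data.Product using (_,_; proj₁; proj₂; ∃-syntax)
open import Data.Sum using (inj₁; inj₂)
open import Data.Vec using (lookup; _[_]≔_) renaming ([] to []ᵥ; _∷_ to _∷ᵥ_)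
import Data.Vec.Properties as Vecₚ
open import Function using (_∘_)
open import Function.Bundles using (Equivalence)
open import Relation.Binary.PropositionalEquality as ≡
  using (refl; sym; cong; cong₂; subst; subst₂; setoid; module ≡-Reasoning)
open import Relation.Nullary using (Dec; yes; no; ¬?)
open import Relation.Nullary.Decidable using (_×-dec_; toWitness; dec-true; isYes≗does)

∑ : {A : Set} → List A → (A → ℤ) → ℤ
∑ xs f = sumℤ (map f xs)

∏ : {A : Set} → List A → (A → ℤ) → ℤ
∏ xs f = prodℤ (map f xs)

syntax ∑ xs (λ x → e) = ∑[ x ∈ xs ] e
syntax ∏ xs (λ x → e) = ∏[ x ∈ xs ] e

module _ {A : Set} where

  ∑-++ : (xs ys : List A) (f : A → ℤ) → ∑ (xs ++ ys) f ≡ ∑ xs f + ∑ ys f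
  ∑-++ []       ys f = sym (ℤₚ.+-identityˡ _)
  ∑-++ (x ∷ xs) ys f = ≡.trans (cong (_+_ (f x)) (∑-++ xs ys f)) (sym (ℤₚ.+-assoc (f x) _ _))

  ∑-cong-∈ : (xs : List A) {f g : A → ℤ} → (∀ x → x ∈ xs → f x ≡ g x) → ∑ xs f ≡ ∑ xs g
  ∑-cong-∈ []       f≗g = refl
  ∑-cong-∈ (x ∷ xs) f≗g = cong₂ _+_ (f≗g x (here refl)) (∑-cong-∈ xs (λ y → f≗g y ∘ there))

  ∑-cong : (xs : List A) {f g : A → ℤ} → (∀ x → f x ≡ g x) → ∑ xs f ≡ ∑ xs g
  ∑-cong xs f≗g = ∑-cong-∈ xs (λ x _ → f≗g x)

  ∏-cong-∈ : (xs : List A) {f g : A → ℤ} → (∀ x → x ∈ xs → f x ≡ g x) → ∏ xs f ≡ ∏ xs g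
  ∏-cong-∈ []       f≗g = refl
  ∏-cong-∈ (x ∷ xs) f≗g = cong₂ _*_ (f≗g x (here refl)) (∏-cong-∈ xs (λ y → f≗g y ∘ there))

  ∏-cong : (xs : List A) {f g : A → ℤ} → (∀ x → f x ≡ g x) → ∏ xs f ≡ ∏ xs g
  ∏-cong xs f≗g = ∏-cong-∈ xs (λ x _ → f≗g x)

  ∏-↭ : {xs ys : List A} (f : A → ℤ) → xs ↭ ys → ∏ xs f ≡ ∏ ys f
  ∏-↭ f xs↭ys = Setoid↭ₚ.foldr-commMonoid (setoid ℤ) ℤₚ.*-1-isCommutativeMonoid
                  (↭⇒↭ₛ (↭ₚ.map⁺ f xs↭ys))

  ∑-+ : (xs : List A) (f g : A → ℤ) → ∑[ x ∈ xs ] (f x + g x) ≡ ∑ xs f + ∑ xs g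
  ∑-+ []       f g = refl
  ∑-+ (x ∷ xs) f g = ≡.trans (cong (_+_ (f x + g x)) (∑-+ xs f g)) (interchange (f x) (g x) _ _)
    where
    interchange : ∀ a b c d → a + b + (c + d) ≡ a + c + (b + d)
    interchange = solve-∀

  ∑-*ˡ : (xs : List A) (c : ℤ) (f : A → ℤ) → ∑[ x ∈ xs ] (c * f x) ≡ c * ∑ xs f
  ∑-*ˡ []       c f = sym (ℤₚ.*-zeroʳ c)
  ∑-*ˡ (x ∷ xs) c f = ≡.trans (cong (_+_ (c * f x)) (∑-*ˡ xs c f)) (sym (ℤₚ.*-distribˡ-+ c (f x) _))

  ∑-*ʳ : (xs : List A) (c : ℤ) (f : A → ℤ) → ∑[ x ∈ xs ] (f x * c) ≡ ∑ xs f * c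
  ∑-*ʳ xs c f = ≡.trans (∑-cong xs (λ x → ℤₚ.*-comm (f x) c))
                        (≡.trans (∑-*ˡ xs c f) (ℤₚ.*-comm c _))

  ∑-const : (xs : List A) (c : ℤ) → ∑[ _ ∈ xs ] c ≡ + length xs * c
  ∑-const []       c = sym (ℤₚ.*-zeroˡ c)
  ∑-const (x ∷ xs) c = ≡.trans (cong (_+_ c) (∑-const xs c)) (sym (ℤₚ.suc-* (+ length xs) c))

  ∑-zero : (xs : List A) → ∑[ _ ∈ xs ] 0ℤ ≡ 0ℤ
  ∑-zero xs = ≡.trans (∑-const xs 0ℤ) (ℤₚ.*-zeroʳ (+ length xs))

module _ {A B : Set} where

  ∑-map : (h : A → B) (xs : List A) (f : B → ℤ) → ∑ (map h xs) f ≡ ∑ xs (f ∘ h)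
  ∑-map h []       f = refl
  ∑-map h (x ∷ xs) f = cong (_+_ (f (h x))) (∑-map h xs f)

  ∑-concatMap : (g : A → List B) (xs : List A) (f : B → ℤ) →
                ∑ (concatMap g xs) f ≡ ∑[ x ∈ xs ] ∑ (g x) f
  ∑-concatMap g []       f = refl
  ∑-concatMap g (x ∷ xs) f = ≡.trans (∑-++ (g x) (concatMap g xs) f)
                                     (cong (_+_ (∑ (g x) f)) (∑-concatMap g xs f))

  ∑-swap : (xs : List A) (ys : List B) (f : A → B → ℤ) →
           ∑[ x ∈ xs ] ∑[ y ∈ ys ] f x y ≡ ∑[ y ∈ ys ] ∑[ x ∈ xs ] f x y
  ∑-swap []       ys f = sym (∑-zero ys)
  ∑-swap (x ∷ xs) ys f = ≡.trans (cong (_+_ (∑ ys (f x))) (∑-swap xs ys f))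
                                 (sym (∑-+ ys (f x) (λ y → ∑[ x ∈ xs ] f x y)))

∑-upTo-suc : ∀ n (f : ℕ → ℤ) → ∑ (upTo (suc n)) f ≡ f 0 + ∑[ a ∈ upTo n ] f (suc a)
∑-upTo-suc n f = cong (_+_ (f 0)) (≡.trans (cong (λ as → ∑ as f) (sym (Listₚ.map-upTo suc n)))
                                       (∑-map suc (upTo n) f))

≡+⇒-≡ : ∀ {a} b c → a ≡ b + c → c ≡ a - b
≡+⇒-≡ b c refl = sym (cancel b c)
  where cancel : ∀ b c → b + c - b ≡ c
        cancel = solve-∀

-≡⇒≡+ : ∀ a b {c} → c ≡ a - b → a ≡ b + c
-≡⇒≡+ a b refl = sym (cancel a b)
  where cancel : ∀ a b → b + (a - b) ≡ a
        cancel = solve-∀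

+≡⇒≡- : ∀ a b {c} → a + b ≡ c → a ≡ c - b
+≡⇒≡- a b refl = sym (cancel a b)
  where cancel : ∀ a b → a + b - b ≡ a
        cancel = solve-∀

≡-⇒+≡ : ∀ {a} b c → a ≡ c - b → a + b ≡ c
≡-⇒+≡ b c refl = cancel b c
  where cancel : ∀ b c → c - b + b ≡ c
        cancel = solve-∀

+-cancelʳ : ∀ a b c → a + c ≡ b + c → a ≡ b
+-cancelʳ a b c eq = ≡.trans (+≡⇒≡- a c eq) (cancel b c)
  where cancel : ∀ b c → b + c - c ≡ b
        cancel = solve-∀

neg-minus : ∀ a b → - (a - b) ≡ b - a
neg-minus = solve-∀

≤-+⇒-≤ : ∀ {a b} c → a ≤ c + b → a - c ≤ b
≤-+⇒-≤ {a} {b} c a≤c+b = subst (a - c ≤_) (cancel c b) (ℤₚ.+-monoˡ-≤ (- c) a≤c+b)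
  where cancel : ∀ c b → c + b - c ≡ b
        cancel = solve-∀

-≤⇒≤-+ : ∀ {a b} c → a - c ≤ b → a ≤ c + b
-≤⇒≤-+ {a} {b} c a-c≤b = subst (_≤ c + b) (cancel a c) (ℤₚ.+-monoʳ-≤ c a-c≤b)
  where cancel : ∀ a c → c + (a - c) ≡ a
        cancel = solve-∀

+≤⇒≤- : ∀ {a b} c → c + a ≤ b → a ≤ b - c
+≤⇒≤- {a} {b} c c+a≤b = subst (_≤ b - c) (cancel c a) (ℤₚ.+-monoˡ-≤ (- c) c+a≤b)
  where cancel : ∀ c a → c + a - c ≡ a
        cancel = solve-∀

≤-⇒+≤ : ∀ {a b} c → a ≤ b - c → c + a ≤ b
≤-⇒+≤ {a} {b} c a≤b-c = subst (c + a ≤_) (cancel b c) (ℤₚ.+-monoʳ-≤ c a≤b-c)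
  where cancel : ∀ b c → c + (b - c) ≡ b
        cancel = solve-∀

⁺-nonpos : ∀ {x} → x ≤ 0ℤ → x ⁺ ≡ 0ℤ
⁺-nonpos = ℤₚ.i≤j⇒i⊔j≡j

⁺-nonneg : ∀ {x} → 0ℤ ≤ x → x ⁺ ≡ x
⁺-nonneg = ℤₚ.i≥j⇒i⊔j≡i

-- Indicators and integer intervals

𝟙 : {P : Set} → Dec P → ℤ
𝟙 (yes _) = 1ℤ
𝟙 (no _)  = 0ℤ

𝟙-yes : {P : Set} (d : Dec P) → P → 𝟙 d ≡ 1ℤ
𝟙-yes (yes _) _ = refl
𝟙-yes (no ¬p) p = ⊥-elim (¬p p)

𝟙-no : {P : Set} (d : Dec P) → ¬ P → 𝟙 d ≡ 0ℤ
𝟙-no (yes p) ¬p = ⊥-elim (¬p p)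
𝟙-no (no _)  _  = refl

𝟙-⇔ : {P Q : Set} (d : Dec P) (e : Dec Q) → (P → Q) → (Q → P) → 𝟙 d ≡ 𝟙 e
𝟙-⇔ (yes p) e to from = sym (𝟙-yes e (to p))
𝟙-⇔ (no ¬p) e to from = sym (𝟙-no e (¬p ∘ from))

𝟙-× : {P Q : Set} (d : Dec P) (e : Dec Q) → 𝟙 (d ×-dec e) ≡ 𝟙 d * 𝟙 e
𝟙-× (yes _) (yes _) = refl
𝟙-× (yes _) (no _)  = refl
𝟙-× (no _)  (yes _) = refl
𝟙-× (no _)  (no _)  = refl

if-then-0≡*𝟙 : {P : Set} (d : Dec P) (c : ℤ) → (if ⌊ d ⌋ then c else 0ℤ) ≡ c * 𝟙 d
if-then-0≡*𝟙 (yes _) c = sym (ℤₚ.*-identityʳ c)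
if-then-0≡*𝟙 (no _)  c = sym (ℤₚ.*-zeroʳ c)

module _ {A : Set} {P : A → Set} (P? : ∀ x → Dec (P x)) where

  ∏-𝟙 : ∀ xs → ∏[ x ∈ xs ] 𝟙 (P? x) ≡ 𝟙 (all? P? xs)
  ∏-𝟙 []       = refl
  ∏-𝟙 (x ∷ xs) = begin
    𝟙 (P? x) * ∏[ x ∈ xs ] 𝟙 (P? x)   ≡⟨ cong (_*_ (𝟙 (P? x))) (∏-𝟙 xs) ⟩
    𝟙 (P? x) * 𝟙 (all? P? xs)         ≡⟨ sym (𝟙-× (P? x) (all? P? xs)) ⟩
    𝟙 (P? x ×-dec all? P? xs)         ≡⟨ 𝟙-⇔ _ (all? P? (x ∷ xs)) (λ (p , ps) → p ∷ ps) All.uncons ⟩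
    𝟙 (all? P? (x ∷ xs))              ∎
    where open ≡-Reasoning

  length-filter : ∀ xs → + length (filter P? xs) ≡ ∑[ x ∈ xs ] 𝟙 (P? x)
  length-filter []       = refl
  length-filter (x ∷ xs) with P? x
  ... | yes _ = cong (_+_ 1ℤ) (length-filter xs)
  ... | no _  = ≡.trans (length-filter xs) (sym (ℤₚ.+-identityˡ _))

infix 4 _≤?_≤?_

_≤?_≤?_ : ∀ lo z hi → Dec (lo ≤ z × z ≤ hi)
lo ≤? z ≤? hi = (lo ℤ.≤? z) ×-dec (z ℤ.≤? hi)

inRange : ℤ → ℤ → ℤ → ℤ
inRange lo hi z = 𝟙 (lo ≤? z ≤? hi)

inRange-+ : ∀ lo hi c z → inRange lo hi (c + z) ≡ inRange (lo - c) (hi - c) z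
inRange-+ lo hi c z = 𝟙-⇔ _ _
  (λ (lo≤ , ≤hi) → ≤-+⇒-≤ c lo≤ , +≤⇒≤- c ≤hi)
  (λ (lo≤ , ≤hi) → -≤⇒≤-+ c lo≤ , ≤-⇒+≤ c ≤hi)

𝟙[0≤x]+x⁺≡[1+x]⁺ : ∀ x → 𝟙 (0ℤ ℤ.≤? x) + x ⁺ ≡ (1ℤ + x) ⁺
𝟙[0≤x]+x⁺≡[1+x]⁺ x with 0ℤ ℤ.≤? x
... | yes 0≤x = ≡.trans (cong (_+_ 1ℤ) (⁺-nonneg 0≤x)) (sym (⁺-nonneg (ℤₚ.i≤j⇒i≤1+j 0≤x)))
... | no  0≰x = ≡.trans (ℤₚ.+-identityˡ _)
                (≡.trans (⁺-nonpos (ℤₚ.<⇒≤ x<0)) (sym (⁺-nonpos (ℤₚ.i<j⇒suc[i]≤j x<0))))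
  where x<0 = ℤₚ.≰⇒> 0≰x

∑-upTo-≟ : ∀ N z → ∑[ c ∈ upTo (suc N) ] 𝟙 (+ c ℤ.≟ z) ≡ inRange 0ℤ (+ N) z
∑-upTo-≟ zero z = ≡.trans (ℤₚ.+-identityʳ _)
  (𝟙-⇔ (0ℤ ℤ.≟ z) (0ℤ ≤? z ≤? 0ℤ) (λ { refl → ℤₚ.≤-refl , ℤₚ.≤-refl })
                                 (λ (0≤z , z≤0) → ℤₚ.≤-antisym 0≤z z≤0))
∑-upTo-≟ (suc N) z = ≡.trans (∑-upTo-suc (suc N) (λ c → 𝟙 (+ c ℤ.≟ z))) (split z)
  where
  none : ∀ z → (∀ c → + suc c ≢ z) → ∑[ c ∈ upTo (suc N) ] 𝟙 (+ suc c ℤ.≟ z) ≡ 0ℤ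
  none z ≢z = ≡.trans (∑-cong (upTo (suc N)) (λ c → 𝟙-no (+ suc c ℤ.≟ z) (≢z c)))
                      (∑-zero (upTo (suc N)))

  split : ∀ z → 𝟙 (0ℤ ℤ.≟ z) + ∑[ c ∈ upTo (suc N) ] 𝟙 (+ suc c ℤ.≟ z) ≡ inRange 0ℤ (+ suc N) z
  split (+ zero) = ≡.trans (cong₂ _+_ (𝟙-yes (0ℤ ℤ.≟ 0ℤ) refl) (none 0ℤ (λ _ ())))
                           (sym (𝟙-yes (0ℤ ≤? 0ℤ ≤? + suc N) (ℤₚ.≤-refl , +≤+ z≤n)))
  split (+ suc k) = begin
    𝟙 (0ℤ ℤ.≟ + suc k) + ∑[ c ∈ upTo (suc N) ] 𝟙 (+ suc c ℤ.≟ + suc k)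
      ≡⟨ cong₂ _+_ (𝟙-no (0ℤ ℤ.≟ + suc k) (λ ())) (∑-cong (upTo (suc N)) (λ c →
           𝟙-⇔ (+ suc c ℤ.≟ + suc k) (+ c ℤ.≟ + k) (cong (+_ ∘ ℕ.pred) ∘ ℤₚ.+-injective) (cong (_+_ 1ℤ)))) ⟩
    0ℤ + ∑[ c ∈ upTo (suc N) ] 𝟙 (+ c ℤ.≟ + k)
      ≡⟨ ℤₚ.+-identityˡ _ ⟩
    ∑[ c ∈ upTo (suc N) ] 𝟙 (+ c ℤ.≟ + k)
      ≡⟨ ∑-upTo-≟ N (+ k) ⟩
    inRange 0ℤ (+ N) (+ k)
      ≡⟨ 𝟙-⇔ (0ℤ ≤? + k ≤? + N) (0ℤ ≤? + suc k ≤? + suc N)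
             (λ { (_ , +≤+ k≤N) → +≤+ z≤n , +≤+ (s≤s k≤N) })
             (λ { (_ , +≤+ (s≤s k≤N)) → +≤+ z≤n , +≤+ k≤N }) ⟩
    inRange 0ℤ (+ suc N) (+ suc k) ∎
    where open ≡-Reasoning
  split -[1+ k ] = ≡.trans (cong₂ _+_ (𝟙-no (0ℤ ℤ.≟ -[1+ k ]) (λ ())) (none -[1+ k ] (λ _ ())))
                           (sym (𝟙-no (0ℤ ≤? -[1+ k ] ≤? + suc N) (λ { (() , _) })))

∑-upTo-inRange : ∀ N lo hi → 0ℤ ≤ lo → hi ℤ.< + N →
                 ∑[ a ∈ upTo N ] inRange lo hi (+ a) ≡ (1ℤ + hi - lo) ⁺
∑-upTo-inRange zero lo hi 0≤lo hi<0 =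
  sym (⁺-nonpos (ℤₚ.+-mono-≤ (ℤₚ.i<j⇒suc[i]≤j hi<0) (ℤₚ.neg-mono-≤ 0≤lo)))
∑-upTo-inRange (suc N) (+ suc l) hi _ hi<1+N = begin
  ∑[ a ∈ upTo (suc N) ] inRange (+ suc l) hi (+ a)
    ≡⟨ ∑-upTo-suc N (λ a → inRange (+ suc l) hi (+ a)) ⟩
  inRange (+ suc l) hi 0ℤ + ∑[ a ∈ upTo N ] inRange (+ suc l) hi (1ℤ + + a)
    ≡⟨ cong₂ _+_ (𝟙-no (+ suc l ≤? 0ℤ ≤? hi) (λ { (+≤+ () , _) }))
                 (∑-cong (upTo N) (inRange-+ (+ suc l) hi 1ℤ ∘ +_)) ⟩
  0ℤ + ∑[ a ∈ upTo N ] inRange (+ l) (hi - 1ℤ) (+ a)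
    ≡⟨ ℤₚ.+-identityˡ _ ⟩
  ∑[ a ∈ upTo N ] inRange (+ l) (hi - 1ℤ) (+ a)
    ≡⟨ ∑-upTo-inRange N (+ l) (hi - 1ℤ) (+≤+ z≤n) (ℤₚ.+-monoˡ-< (- 1ℤ) hi<1+N) ⟩
  (1ℤ + (hi - 1ℤ) - + l) ⁺
    ≡⟨ cong _⁺ (shift hi (+ l)) ⟩
  (1ℤ + hi - + suc l) ⁺ ∎
  where
  open ≡-Reasoning
  shift : ∀ hi l → 1ℤ + (hi - 1ℤ) - l ≡ 1ℤ + hi - (1ℤ + l)
  shift = solve-∀
∑-upTo-inRange (suc N) (+ zero) hi _ hi<1+N = begin
  ∑[ a ∈ upTo (suc N) ] inRange 0ℤ hi (+ a)
    ≡⟨ ∑-upTo-suc N (λ a → inRange 0ℤ hi (+ a)) ⟩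
  inRange 0ℤ hi 0ℤ + ∑[ a ∈ upTo N ] inRange 0ℤ hi (1ℤ + + a)
    ≡⟨ cong₂ _+_ (𝟙-⇔ (0ℤ ≤? 0ℤ ≤? hi) (0ℤ ℤ.≤? hi) proj₂ (ℤₚ.≤-refl ,_))
                 (∑-cong (upTo N) (λ a → ≡.trans (inRange-+ 0ℤ hi 1ℤ (+ a))
                   (𝟙-⇔ (-[1+ 0 ] ≤? + a ≤? hi - 1ℤ) (0ℤ ≤? + a ≤? hi - 1ℤ)
                        (λ (_ , a≤) → +≤+ z≤n , a≤) (λ (_ , a≤) → ℤ.-≤+ , a≤)))) ⟩
  𝟙 (0ℤ ℤ.≤? hi) + ∑[ a ∈ upTo N ] inRange 0ℤ (hi - 1ℤ) (+ a)
    ≡⟨ cong (_+_ (𝟙 (0ℤ ℤ.≤? hi)))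
            (∑-upTo-inRange N 0ℤ (hi - 1ℤ) ℤₚ.≤-refl (ℤₚ.+-monoˡ-< (- 1ℤ) hi<1+N)) ⟩
  𝟙 (0ℤ ℤ.≤? hi) + (1ℤ + (hi - 1ℤ) - 0ℤ) ⁺
    ≡⟨ cong (λ x → 𝟙 (0ℤ ℤ.≤? hi) + x ⁺) (shift hi) ⟩
  𝟙 (0ℤ ℤ.≤? hi) + hi ⁺
    ≡⟨ 𝟙[0≤x]+x⁺≡[1+x]⁺ hi ⟩
  (1ℤ + hi) ⁺
    ≡⟨ cong _⁺ (sym (ℤₚ.+-identityʳ (1ℤ + hi))) ⟩
  (1ℤ + hi - 0ℤ) ⁺ ∎
  where
  open ≡-Reasoning
  shift : ∀ hi → 1ℤ + (hi - 1ℤ) - 0ℤ ≡ hi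
  shift = solve-∀

-- Sums over the box, one coordinate at a time

module _ {n : ℕ} where

  width : Vec ℕ n → Fin n → ℤ
  width m v = + suc (lookup m v)

  range : Vec ℕ n → Fin n → List ℕ
  range m v = upTo (suc (lookup m v))

  -- the sum of f over the box points agreeing with x off W (when W has no repetitions)
  sweep : Vec ℕ n → List (Fin n) → (Vec ℕ n → ℤ) → Vec ℕ n → ℤ
  sweep m []      f x = f x
  sweep m (v ∷ W) f x = ∑[ a ∈ range m v ] sweep m W f (x [ v ]≔ a)

  IndependentOf : List (Fin n) → (Vec ℕ n → ℤ) → Set
  IndependentOf W g = ∀ v → v ∈ W → ∀ y a → g (y [ v ]≔ a) ≡ g y

∑-box-∷ : ∀ {n} k (m : Vec ℕ n) f →
          ∑ (box (k ∷ᵥ m)) f ≡ ∑[ a ∈ upTo (suc k) ] ∑[ y ∈ box m ] f (a ∷ᵥ y)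
∑-box-∷ k m f = ≡.trans (∑-concatMap (λ a → map (a ∷ᵥ_) (box m)) (upTo (suc k)) f)
                        (∑-cong (upTo (suc k)) (λ a → ∑-map (a ∷ᵥ_) (box m) f))

∑-box-resample : ∀ {n} (m : Vec ℕ n) v (f : Vec ℕ n → ℤ) →
                 ∑[ x ∈ box m ] ∑[ a ∈ range m v ] f (x [ v ]≔ a) ≡ width m v * ∑ (box m) f
∑-box-resample (k ∷ᵥ m) fzero f = begin
  ∑[ x ∈ box (k ∷ᵥ m) ] ∑[ a ∈ K ] f (x [ fzero ]≔ a)
    ≡⟨ ∑-box-∷ k m _ ⟩
  ∑[ _ ∈ K ] ∑[ y ∈ box m ] ∑[ a ∈ K ] f (a ∷ᵥ y)
    ≡⟨ ∑-const K _ ⟩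
  + length K * ∑[ y ∈ box m ] ∑[ a ∈ K ] f (a ∷ᵥ y)
    ≡⟨ cong₂ _*_ (cong +_ (Listₚ.length-upTo (suc k))) (∑-swap (box m) K (λ y a → f (a ∷ᵥ y))) ⟩
  + suc k * ∑[ a ∈ K ] ∑[ y ∈ box m ] f (a ∷ᵥ y)
    ≡⟨ cong (_*_ (+ suc k)) (sym (∑-box-∷ k m f)) ⟩
  + suc k * ∑ (box (k ∷ᵥ m)) f ∎
  where
  open ≡-Reasoning
  K = upTo (suc k)
∑-box-resample (k ∷ᵥ m) (fsuc v) f = begin
  ∑[ x ∈ box (k ∷ᵥ m) ] ∑[ a ∈ range m v ] f (x [ fsuc v ]≔ a)
    ≡⟨ ∑-box-∷ k m _ ⟩
  ∑[ b ∈ K ] ∑[ y ∈ box m ] ∑[ a ∈ range m v ] f (b ∷ᵥ (y [ v ]≔ a))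
    ≡⟨ ∑-cong K (λ b → ∑-box-resample m v (λ y → f (b ∷ᵥ y))) ⟩
  ∑[ b ∈ K ] (width m v * ∑[ y ∈ box m ] f (b ∷ᵥ y))
    ≡⟨ ∑-*ˡ K (width m v) (λ b → ∑[ y ∈ box m ] f (b ∷ᵥ y)) ⟩
  width m v * ∑[ b ∈ K ] ∑[ y ∈ box m ] f (b ∷ᵥ y)
    ≡⟨ cong (_*_ (width m v)) (sym (∑-box-∷ k m f)) ⟩
  width m v * ∑ (box (k ∷ᵥ m)) f ∎
  where
  open ≡-Reasoning
  K = upTo (suc k)

module _ {n : ℕ} (m : Vec ℕ n) where

  ∑-box-sweep : ∀ W f → ∑ (box m) (sweep m W f) ≡ ∏ W (width m) * ∑ (box m) f
  ∑-box-sweep []      f = sym (ℤₚ.*-identityˡ _)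
  ∑-box-sweep (v ∷ W) f = begin
    ∑ (box m) (sweep m (v ∷ W) f)                ≡⟨ ∑-box-resample m v (sweep m W f) ⟩
    width m v * ∑ (box m) (sweep m W f)          ≡⟨ cong (_*_ (width m v)) (∑-box-sweep W f) ⟩
    width m v * (∏ W (width m) * ∑ (box m) f)    ≡⟨ sym (ℤₚ.*-assoc (width m v) (∏ W (width m)) _) ⟩
    ∏ (v ∷ W) (width m) * ∑ (box m) f            ∎
    where open ≡-Reasoning

  sweep-cong : ∀ W {f g} → (∀ y → f y ≡ g y) → ∀ x → sweep m W f x ≡ sweep m W g x
  sweep-cong []      f≗g x = f≗g x
  sweep-cong (v ∷ W) f≗g x = ∑-cong (range m v) (λ a → sweep-cong W f≗g (x [ v ]≔ a))

  sweep-++ : ∀ U V f x → sweep m (U ++ V) f x ≡ sweep m U (sweep m V f) x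
  sweep-++ []      V f x = refl
  sweep-++ (u ∷ U) V f x = ∑-cong (range m u) (λ a → sweep-++ U V f (x [ u ]≔ a))

  sweep-*ʳ : ∀ W f c x → sweep m W (λ y → f y * c) x ≡ sweep m W f x * c
  sweep-*ʳ []      f c x = refl
  sweep-*ʳ (v ∷ W) f c x = ≡.trans (∑-cong (range m v) (λ a → sweep-*ʳ W f c (x [ v ]≔ a)))
                                   (∑-*ʳ (range m v) c (λ a → sweep m W f (x [ v ]≔ a)))

  sweep-*ˡ : ∀ W g f → IndependentOf W g → ∀ x → sweep m W (λ y → g y * f y) x ≡ g x * sweep m W f x
  sweep-*ˡ []      g f _   x = refl
  sweep-*ˡ (v ∷ W) g f ind x = begin
    ∑[ a ∈ range m v ] sweep m W (λ y → g y * f y) (x [ v ]≔ a)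
      ≡⟨ ∑-cong (range m v) (λ a → sweep-*ˡ W g f (λ w → ind w ∘ there) (x [ v ]≔ a)) ⟩
    ∑[ a ∈ range m v ] (g (x [ v ]≔ a) * sweep m W f (x [ v ]≔ a))
      ≡⟨ ∑-cong (range m v) (λ a → cong (_* sweep m W f (x [ v ]≔ a)) (ind v (here refl) x a)) ⟩
    ∑[ a ∈ range m v ] (g x * sweep m W f (x [ v ]≔ a))
      ≡⟨ ∑-*ˡ (range m v) (g x) _ ⟩
    g x * sweep m (v ∷ W) f x ∎
    where open ≡-Reasoning

  sweep-const : ∀ W c x → sweep m W (λ _ → c) x ≡ ∏ W (width m) * c
  sweep-const []      c x = sym (ℤₚ.*-identityˡ c)
  sweep-const (v ∷ W) c x = begin
    ∑[ a ∈ range m v ] sweep m W (λ _ → c) (x [ v ]≔ a)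
      ≡⟨ ∑-cong (range m v) (λ a → sweep-const W c (x [ v ]≔ a)) ⟩
    ∑[ _ ∈ range m v ] (∏ W (width m) * c)
      ≡⟨ ∑-const (range m v) _ ⟩
    + length (range m v) * (∏ W (width m) * c)
      ≡⟨ cong (λ k → + k * (∏ W (width m) * c)) (Listₚ.length-upTo (suc (lookup m v))) ⟩
    width m v * (∏ W (width m) * c)
      ≡⟨ sym (ℤₚ.*-assoc (width m v) (∏ W (width m)) c) ⟩
    ∏ (v ∷ W) (width m) * c ∎
    where open ≡-Reasoning

sweep-map-suc : ∀ {n} k (m : Vec ℕ n) W f a y →
                sweep (k ∷ᵥ m) (map fsuc W) f (a ∷ᵥ y) ≡ sweep m W (λ z → f (a ∷ᵥ z)) y
sweep-map-suc k m []      f a y = refl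
sweep-map-suc k m (w ∷ W) f a y = ∑-cong (range m w) (λ b → sweep-map-suc k m W f a (y [ w ]≔ b))

sweep-allFin : ∀ {n} (m : Vec ℕ n) f x → sweep m (allFin n) f x ≡ ∑ (box m) f
sweep-allFin []ᵥ f []ᵥ = sym (ℤₚ.+-identityʳ _)
sweep-allFin {suc n} (k ∷ᵥ m) f (_ ∷ᵥ y) = begin
  ∑[ a ∈ K ] sweep (k ∷ᵥ m) (Data.List.tabulate fsuc) f (a ∷ᵥ y)
    ≡⟨ ∑-cong K (λ a → cong (λ W → sweep (k ∷ᵥ m) W f (a ∷ᵥ y))
                            (sym (Listₚ.map-tabulate (λ i → i) fsuc))) ⟩
  ∑[ a ∈ K ] sweep (k ∷ᵥ m) (map fsuc (allFin n)) f (a ∷ᵥ y)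
    ≡⟨ ∑-cong K (λ a → ≡.trans (sweep-map-suc k m (allFin n) f a y) (sweep-allFin m _ y)) ⟩
  ∑[ a ∈ K ] ∑[ z ∈ box m ] f (a ∷ᵥ z)
    ≡⟨ sym (∑-box-∷ k m f) ⟩
  ∑ (box (k ∷ᵥ m)) f ∎
  where
  open ≡-Reasoning
  K = upTo (suc k)

length-box : ∀ {n} (m : Vec ℕ n) → + length (box m) ≡ ∏ (allFin n) (width m)
length-box m = begin
  + length (box m)                                       ≡⟨ sym (ℤₚ.*-identityʳ _) ⟩
  + length (box m) * 1ℤ                                  ≡⟨ sym (∑-const (box m) 1ℤ) ⟩
  ∑[ _ ∈ box m ] 1ℤ                                      ≡⟨ sym (sweep-allFin m (λ _ → 1ℤ) x) ⟩
  sweep m (allFin _) (λ _ → 1ℤ) x                        ≡⟨ sweep-const m (allFin _) 1ℤ x ⟩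
  ∏ (allFin _) (width m) * 1ℤ                            ≡⟨ ℤₚ.*-identityʳ _ ⟩
  ∏ (allFin _) (width m)                                 ∎
  where
  open ≡-Reasoning
  x = Data.Vec.replicate _ 0

-- Walks in a gain graph

Unique-++⁻ : {X : Set} (xs ys : List X) → Unique (xs ++ ys) →
             Unique xs × Unique ys × (∀ {x} → x ∈ xs → x ∉ ys)
Unique-++⁻ []       ys u        = [] , u , λ ()
Unique-++⁻ (x ∷ xs) ys (x∉ ∷ u) with Unique-++⁻ xs ys u
... | uxs , uys , disjoint =
  Allₚ.++⁻ˡ xs x∉ ∷ uxs , uys ,
  λ { (here refl) y∈ → All.lookup (Allₚ.++⁻ʳ xs x∉) y∈ refl ; (there p) y∈ → disjoint p y∈ }

Unique-head : {X : Set} {x : X} {xs : List X} → Unique (x ∷ xs) → x ∉ xs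
Unique-head = Uniqueₚ.Unique[x∷xs]⇒x∉xs

Unique-head-≢ : {X : Set} {x y : X} {xs : List X} → Unique (x ∷ xs) → y ∈ xs → x ≢ y
Unique-head-≢ (x∉ ∷ _) = All.lookup x∉

Unique-tail : {X : Set} {x : X} {xs : List X} → Unique (x ∷ xs) → Unique xs
Unique-tail (_ ∷ u) = u

module Walks {n : ℕ} (A : List (Hyp n)) where
  open GainGraph A
  open import Data.List.Membership.DecPropositional (Finₚ._≟_ {n}) using (_∈?_)
  open import Data.List.Membership.DecPropositional (Finₚ._≟_ {E}) using () renaming (_∈?_ to _∈ᴱ?_)

  opposite : Dart → Dart
  opposite (e , fwd) = e , bwd
  opposite (e , bwd) = e , fwd

  reverseWalk : List Dart → List Dart
  reverseWalk []       = []
  reverseWalk (d ∷ ds) = reverseWalk ds ++ opposite d ∷ []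

  IsWalk-++ : ∀ {u v w ds es} → IsWalk u ds v → IsWalk v es w → IsWalk u (ds ++ es) w
  IsWalk-++ nil         q = q
  IsWalk-++ (cons s≡ p) q = cons s≡ (IsWalk-++ p q)

  IsWalk-++⁻ : ∀ {u w} ds {es} → IsWalk u (ds ++ es) w → ∃[ v ] (IsWalk u ds v × IsWalk v es w)
  IsWalk-++⁻ []       p = _ , nil , p
  IsWalk-++⁻ (d ∷ ds) (cons s≡ p) with IsWalk-++⁻ ds p
  ... | v , p₁ , p₂ = v , cons s≡ p₁ , p₂

  walkGain-++ : ∀ ds es → walkGain (ds ++ es) ≡ walkGain ds + walkGain es
  walkGain-++ []       es = sym (ℤₚ.+-identityˡ _)
  walkGain-++ (d ∷ ds) es = ≡.trans (cong (_+_ (dgain d)) (walkGain-++ ds es))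
                                    (sym (ℤₚ.+-assoc (dgain d) (walkGain ds) (walkGain es)))

  InSet-++⁺ : ∀ {B} ds es → InSet B ds → InSet B es → InSet B (ds ++ es)
  InSet-++⁺ {B} ds es i j = subst (All (_∈ₛ B)) (sym (Listₚ.map-++ proj₁ ds es)) (Allₚ.++⁺ i j)

  InSet-++⁻ : ∀ {B} ds es → InSet B (ds ++ es) → InSet B ds × InSet B es
  InSet-++⁻ {B} ds es i =
    let i′ = subst (All (_∈ₛ B)) (Listₚ.map-++ proj₁ ds es) i
    in Allₚ.++⁻ˡ (edgesOf ds) i′ , Allₚ.++⁻ʳ (edgesOf ds) i′

  InSet-∪⁅⁆⁻ : ∀ {B e} ds → InSet (B ∪ ⁅ e ⁆) ds → e ∉ edgesOf ds → InSet B ds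
  InSet-∪⁅⁆⁻ []       []       _  = []
  InSet-∪⁅⁆⁻ {B} {e} (d ∷ ds) (i ∷ is) e∉ with Subsetₚ.x∈p∪q⁻ B ⁅ e ⁆ i
  ... | inj₁ i′ = i′ ∷ InSet-∪⁅⁆⁻ ds is (e∉ ∘ there)
  ... | inj₂ i′ = ⊥-elim (e∉ (here (sym (Subsetₚ.x∈⁅y⁆⇒x≡y e i′))))

  IsWalk-reverse : ∀ {u w ds} → IsWalk u ds w → IsWalk w (reverseWalk ds) u
  IsWalk-reverse nil = nil
  IsWalk-reverse {ds = (e , fwd) ∷ _} (cons refl p) = IsWalk-++ (IsWalk-reverse p) (cons refl nil)
  IsWalk-reverse {ds = (e , bwd) ∷ _} (cons refl p) = IsWalk-++ (IsWalk-reverse p) (cons refl nil)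

  walkGain-reverse : ∀ ds → walkGain (reverseWalk ds) ≡ - walkGain ds
  walkGain-reverse []       = refl
  walkGain-reverse (d ∷ ds) = begin
    walkGain (reverseWalk ds ++ opposite d ∷ [])
      ≡⟨ walkGain-++ (reverseWalk ds) (opposite d ∷ []) ⟩
    walkGain (reverseWalk ds) + (dgain (opposite d) + 0ℤ)
      ≡⟨ cong₂ (λ x y → x + (y + 0ℤ)) (walkGain-reverse ds) (dgain-opposite d) ⟩
    - walkGain ds + (- dgain d + 0ℤ)
      ≡⟨ regroup (walkGain ds) (dgain d) ⟩
    - (dgain d + walkGain ds) ∎
    where
    open ≡-Reasoning
    dgain-opposite : ∀ d → dgain (opposite d) ≡ - dgain d
    dgain-opposite (e , fwd) = refl
    dgain-opposite (e , bwd) = sym (ℤₚ.neg-involutive _)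
    regroup : ∀ a b → - a + (- b + 0ℤ) ≡ - (b + a)
    regroup = solve-∀

  InSet-reverse : ∀ {B} ds → InSet B ds → InSet B (reverseWalk ds)
  InSet-reverse []                  []      = []
  InSet-reverse ((e , fwd) ∷ ds) (i ∷ is) = InSet-++⁺ (reverseWalk ds) _ (InSet-reverse ds is) (i ∷ [])
  InSet-reverse ((e , bwd) ∷ ds) (i ∷ is) = InSet-++⁺ (reverseWalk ds) _ (InSet-reverse ds is) (i ∷ [])

  target∈ends : ∀ {u w d ds} → IsWalk u (d ∷ ds) w → w ∈ map end (d ∷ ds)
  target∈ends (cons _ nil)                  = here refl
  target∈ends (cons _ (cons {d = d} s≡ p)) = there (target∈ends {d = d} (cons s≡ p))

  target∈vertices : ∀ {u w ds} → IsWalk u ds w → w ∈ vertices u ds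
  target∈vertices nil                      = here refl
  target∈vertices {ds = d ∷ _} (cons s≡ p) = there (target∈ends {d = d} (cons s≡ p))

  start∈vertices : ∀ {u w ds d} → IsWalk u ds w → d ∈ ds → start d ∈ vertices u ds
  start∈vertices (cons refl p) (here refl) = here refl
  start∈vertices (cons refl p) (there d∈)  = there (start∈vertices p d∈)

  closedPath⇒[] : ∀ {u ds} → IsWalk u ds u → Unique (vertices u ds) → ds ≡ []
  closedPath⇒[] {ds = []}    _ _ = refl
  closedPath⇒[] {ds = d ∷ _} p u = ⊥-elim (Unique-head u (target∈ends {d = d} p))

  data SameEdge (d d′ : Dart) : Set where
    parallel : start d ≡ start d′ → end d ≡ end d′ → SameEdge d d′
    opposed  : start d ≡ end d′ → end d ≡ start d′ → dgain d + dgain d′ ≡ 0ℤ → SameEdge d d′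

  sameEdge : ∀ d d′ → proj₁ d ≡ proj₁ d′ → SameEdge d d′
  sameEdge (e , fwd) (.e , fwd) refl = parallel refl refl
  sameEdge (e , bwd) (.e , bwd) refl = parallel refl refl
  sameEdge (e , fwd) (.e , bwd) refl = opposed refl refl (ℤₚ.+-inverseʳ (gain (edge e)))
  sameEdge (e , bwd) (.e , fwd) refl = opposed refl refl (ℤₚ.+-inverseˡ (gain (edge e)))

  path⇒uniqueEdges : ∀ {u w ds} → IsWalk u ds w → Unique (vertices u ds) → Unique (edgesOf ds)
  path⇒uniqueEdges nil _ = []
  path⇒uniqueEdges {ds = d ∷ ds} (cons refl p) u =
    All.tabulate (λ e∈ d≡ → notLater e∈ d≡) ∷ path⇒uniqueEdges p (Unique-tail u)
    where
    notLater : ∀ {e} → e ∈ edgesOf ds → proj₁ d ≢ e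
    notLater e∈ d≡ with ∈ₚ.∈-map⁻ proj₁ {xs = ds} e∈
    ... | d′ , d′∈ , refl with sameEdge d d′ d≡
    ... | parallel s≡ _  = Unique-head-≢ u (start∈vertices p d′∈) s≡
    ... | opposed s≡ _ _ = Unique-head-≢ u (there (∈ₚ.∈-map⁺ end d′∈)) s≡

  splitWalkAt : ∀ {u w v ds} → IsWalk u ds w → v ∈ vertices u ds →
                ∃[ ds₁ ] ∃[ ds₂ ] (ds ≡ ds₁ ++ ds₂ × IsWalk u ds₁ v × IsWalk v ds₂ w)
  splitWalkAt {ds = ds} p (here refl) = [] , ds , refl , nil , p
  splitWalkAt {ds = d ∷ ds} (cons s≡ p) (there v∈) with splitWalkAt p v∈
  ... | ds₁ , ds₂ , refl , p₁ , p₂ = d ∷ ds₁ , ds₂ , refl , cons s≡ p₁ , p₂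

  module _ {B : Subset E} (balanced : Balanced B) where

    -- d followed by ds is a circle unless ds starts by traversing d's edge backwards
    returnPath-gain : ∀ d ds → IsWalk (end d) ds (start d) → Unique (vertices (end d) ds) →
                      InSet B (d ∷ ds) → dgain d + walkGain ds ≡ 0ℤ
    returnPath-gain d ds p u i with proj₁ d ∈ᴱ? edgesOf ds
    ... | no d∉ = balanced (start d) (d ∷ ds) (cons refl p , nonEmpty , uniqueEdges , u) i
      where
      uniqueEdges : Unique (edgesOf (d ∷ ds))
      uniqueEdges = All.tabulate (λ e∈ d≡ → d∉ (subst (_∈ edgesOf ds) (sym d≡) e∈))
                    ∷ path⇒uniqueEdges p u
    returnPath-gain d (d₁ ∷ ds) (cons s≡ p) u i | yes d∈ with ∈ₚ.∈-map⁻ proj₁ {xs = d₁ ∷ ds} d∈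
    ... | d′ , here refl , d≡ with sameEdge d d₁ d≡
    ...   | parallel s≡′ _ =
      ⊥-elim (Unique-head-≢ u (target∈ends {d = d₁} (cons s≡ p)) (sym (≡.trans s≡′ s≡)))
    ...   | opposed s≡′ _ g≡ with closedPath⇒[] (subst (IsWalk (end d₁) ds) s≡′ p) (Unique-tail u)
    ...     | refl = ≡.trans (cong (_+_ (dgain d)) (ℤₚ.+-identityʳ (dgain d₁))) g≡
    returnPath-gain d (d₁ ∷ ds) (cons s≡ p) u i | yes d∈ | d′ , there d′∈ , d≡ with sameEdge d d′ d≡
    ... | parallel _ e≡  = ⊥-elim (Unique-head-≢ u (there (∈ₚ.∈-map⁺ end d′∈)) e≡)
    ... | opposed _ e≡ _ = ⊥-elim (Unique-head-≢ u (start∈vertices p d′∈) e≡)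

    walk⇒path : ∀ {u w} ds → IsWalk u ds w → InSet B ds →
                ∃[ ps ] (IsPath u ps w × InSet B ps × walkGain ps ≡ walkGain ds)
    walk⇒path []       nil         []       = [] , (nil , [] ∷ []) , [] , refl
    walk⇒path (d ∷ ds) (cons refl p) (i ∷ is) with walk⇒path ds p is
    ... | ps , (pp , up) , ips , g≡ with start d ∈? vertices (end d) ps
    ...   | no s∉ = d ∷ ps , (cons refl pp , unique) , i ∷ ips , cong (_+_ (dgain d)) g≡
      where unique = All.tabulate (λ v∈ s≡ → s∉ (subst (_∈ vertices (end d) ps) (sym s≡) v∈)) ∷ up
    ...   | yes s∈ with splitWalkAt pp s∈
    ...     | ps₁ , ps₂ , refl , p₁ , p₂ = ps₂ , (p₂ , unique₂) , proj₂ (InSet-++⁻ ps₁ ps₂ ips) , gain≡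
      where
      split = Unique-++⁻ (vertices (end d) ps₁) (map end ps₂)
                         (subst Unique (cong (end d ∷_) (Listₚ.map-++ end ps₁ ps₂)) up)
      unique₂ : Unique (start d ∷ map end ps₂)
      unique₂ = All.tabulate (λ v∈ s≡ → proj₂ (proj₂ split) (target∈vertices p₁)
                                                             (subst (_∈ map end ps₂) (sym s≡) v∈))
                ∷ proj₁ (proj₂ split)
      loop : dgain d + walkGain ps₁ ≡ 0ℤ
      loop = returnPath-gain d ps₁ p₁ (proj₁ split) (i ∷ proj₁ (InSet-++⁻ ps₁ ps₂ ips))
      gain≡ : walkGain ps₂ ≡ dgain d + walkGain ds
      gain≡ = begin
        walkGain ps₂                             ≡⟨ sym (ℤₚ.+-identityˡ _) ⟩
        0ℤ + walkGain ps₂                        ≡⟨ cong (_+ walkGain ps₂) (sym loop) ⟩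
        dgain d + walkGain ps₁ + walkGain ps₂    ≡⟨ ℤₚ.+-assoc (dgain d) _ _ ⟩
        dgain d + (walkGain ps₁ + walkGain ps₂)  ≡⟨ cong (_+_ (dgain d)) (sym (walkGain-++ ps₁ ps₂)) ⟩
        dgain d + walkGain (ps₁ ++ ps₂)          ≡⟨ cong (_+_ (dgain d)) g≡ ⟩
        dgain d + walkGain ds                    ∎
        where open ≡-Reasoning

    closedWalk-gain : ∀ {u} ds → IsWalk u ds u → InSet B ds → walkGain ds ≡ 0ℤ
    closedWalk-gain ds p i with walk⇒path ds p i
    ... | ps , (pp , up) , _ , g≡ with closedPath⇒[] pp up
    ... | refl = sym g≡

-- The edges satisfied by a point

coord : ∀ {n} → Vec ℕ n → Fin n → ℤ
coord x v = + lookup x v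

module Satisfied {n : ℕ} (A : List (Hyp n)) (x : Vec ℕ n) where
  open GainGraph A
  open Walks A

  Satisfies : Hyp n → Set
  Satisfies h = coord x (tgt h) ≡ coord x (src h) + gain h

  satisfies? : ∀ h → Dec (Satisfies h)
  satisfies? h = coord x (tgt h) ℤ.≟ coord x (src h) + gain h

  satisfied : Subset E
  satisfied = Data.Vec.tabulate (λ e → ⌊ satisfies? (edge e) ⌋)

  ∈satisfied⇒ : ∀ {e} → e ∈ₛ satisfied → Satisfies (edge e)
  ∈satisfied⇒ {e} e∈ = toWitness (Equivalence.from Boolₚ.T-≡
    (≡.trans (sym (Vecₚ.lookup∘tabulate _ e)) (Vecₚ.[]=⇒lookup e∈)))

  ⇒∈satisfied : ∀ e → Satisfies (edge e) → e ∈ₛ satisfied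
  ⇒∈satisfied e s = Vecₚ.lookup⇒[]= e satisfied
    (≡.trans (Vecₚ.lookup∘tabulate _ e)
             (≡.trans (isYes≗does (satisfies? (edge e))) (dec-true (satisfies? (edge e)) s)))

  dartGain-satisfied : ∀ d → proj₁ d ∈ₛ satisfied → dgain d ≡ coord x (end d) - coord x (start d)
  dartGain-satisfied (e , fwd) e∈ = ≡+⇒-≡ (coord x (src (edge e))) _ (∈satisfied⇒ e∈)
  dartGain-satisfied (e , bwd) e∈ =
    ≡.trans (cong -_ (≡+⇒-≡ (coord x (src (edge e))) _ (∈satisfied⇒ e∈)))
            (neg-minus (coord x (tgt (edge e))) (coord x (src (edge e))))

  satisfies-dartGain : ∀ d → dgain d ≡ coord x (end d) - coord x (start d) → Satisfies (edge (proj₁ d))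
  satisfies-dartGain (e , fwd) g≡ = -≡⇒≡+ (coord x (tgt (edge e))) (coord x (src (edge e))) g≡
  satisfies-dartGain (e , bwd) g≡ = -≡⇒≡+ (coord x (tgt (edge e))) (coord x (src (edge e)))
    (≡.trans (sym (ℤₚ.neg-involutive _))
             (≡.trans (cong -_ g≡) (neg-minus (coord x (src (edge e))) (coord x (tgt (edge e))))))

  walkGain-satisfied : ∀ {u w} ds → IsWalk u ds w → InSet satisfied ds →
                       walkGain ds ≡ coord x w - coord x u
  walkGain-satisfied {u} []       nil           []       = sym (ℤₚ.+-inverseʳ (coord x u))
  walkGain-satisfied {w = w} (d ∷ ds) (cons refl p) (i ∷ is) =
    ≡.trans (cong₂ _+_ (dartGain-satisfied d i) (walkGain-satisfied ds p is))
            (≡.trans (ℤₚ.+-comm (coord x (end d) - coord x (start d)) _)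
                     (ℤₚ.+-minus-telescope (coord x w) (coord x (end d)) (coord x (start d))))

  satisfied-balanced : Balanced satisfied
  satisfied-balanced u ds (p , _) i = ≡.trans (walkGain-satisfied ds p i) (ℤₚ.+-inverseʳ (coord x u))

  satisfied-closed : Closed satisfied
  satisfied-closed e (u , ds , (p , _ , uniqueEdges , _) , i , e∈ , g≡0)
    with ∈ₚ.∈-map⁻ proj₁ {xs = ds} e∈
  ... | d , d∈ , refl with ∈ₚ.∈-∃++ d∈
  ... | ds₁ , ds₂ , refl with IsWalk-++⁻ ds₁ p
  ... | _ , p₁ , cons s≡ p₂ = ⇒∈satisfied (proj₁ d) (satisfies-dartGain d gain-d)
    where
    split = Unique-++⁻ (edgesOf ds₁) (proj₁ d ∷ edgesOf ds₂)
                       (subst Unique (Listₚ.map-++ proj₁ ds₁ (d ∷ ds₂)) uniqueEdges)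
    i₁₂ = InSet-++⁻ ds₁ (d ∷ ds₂) i
    i₁ = InSet-∪⁅⁆⁻ ds₁ (proj₁ i₁₂) (λ e∈₁ → proj₂ (proj₂ split) e∈₁ (here refl))
    i₂ = InSet-∪⁅⁆⁻ ds₂ (All.tail (proj₂ i₁₂)) (Unique-head (proj₁ (proj₂ split)))
    middle : ∀ g₁ g g₂ xu xs xe → g₁ ≡ xs - xu → g₂ ≡ xu - xe → g₁ + (g + g₂) ≡ 0ℤ → g ≡ xe - xs
    middle _ g _ xu xs xe refl refl sum≡0 =
      ≡.trans (rearrange g xu xs xe) (≡.trans (cong (_+_ (xe - xs)) sum≡0) (ℤₚ.+-identityʳ _))
      where rearrange : ∀ g xu xs xe → g ≡ (xe - xs) + ((xs - xu) + (g + (xu - xe)))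
            rearrange = solve-∀
    gain-d : dgain d ≡ coord x (end d) - coord x (start d)
    gain-d = middle (walkGain ds₁) (dgain d) (walkGain ds₂)
                    (coord x u) (coord x (start d)) (coord x (end d))
               (≡.trans (walkGain-satisfied ds₁ p₁ i₁) (cong (λ v → coord x v - coord x u) (sym s≡)))
               (walkGain-satisfied ds₂ p₂ i₂)
               (≡.trans (sym (walkGain-++ ds₁ (d ∷ ds₂))) g≡0)

  avoids⇒satisfied≡⊥ : Avoids A x → satisfied ≡ ⊥
  avoids⇒satisfied≡⊥ avoids = Subsetₚ.Empty-unique
    (λ (e , e∈) → All.lookup avoids (∈ₚ.∈-lookup e) (∈satisfied⇒ e∈))

  satisfied≡⊥⇒avoids : satisfied ≡ ⊥ → Avoids A x
  satisfied≡⊥⇒avoids S≡⊥ = All.tabulate λ h∈ s →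
    Subsetₚ.∉⊥ (subst (Any.index h∈ ∈ₛ_) S≡⊥
                      (⇒∈satisfied (Any.index h∈) (subst Satisfies (Anyₚ.lookup-index h∈) s)))

-- Potentials on the blocks of a balanced set

module BlockPotentials {n : ℕ} (A : List (Hyp n)) (loopless : All (λ h → src h ≢ tgt h) A) where
  open GainGraph A
  open Walks A

  module _ {B : Subset E} {b : Block} (isB : IsBlock B b) where

    W-nonEmpty : NonEmpty (W b)
    W-nonEmpty = proj₁ isB

    W-closed : ∀ v w ds → v ∈ W b → IsPath v ds w → InSet B ds → w ∈ W b
    W-closed = proj₁ (proj₂ (proj₂ isB))

    t∈W : t b ∈ W b
    t∈W = proj₁ (proj₂ (proj₂ (proj₂ isB)))

    t-top : ∀ v ds → v ∈ W b → IsPath v ds (t b) → InSet B ds → 0ℤ ≤ walkGain ds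
    t-top = proj₁ (proj₂ (proj₂ (proj₂ (proj₂ isB))))

    g-attained : ∃[ v ] ∃[ w ] ∃[ ds ] (v ∈ W b × IsPath v ds w × InSet B ds × walkGain ds ≡ g b)
    g-attained = proj₁ (proj₂ (proj₂ (proj₂ (proj₂ (proj₂ isB)))))

    g-max : ∀ v w ds → v ∈ W b → IsPath v ds w → InSet B ds → walkGain ds ≤ g b
    g-max = proj₁ (proj₂ (proj₂ (proj₂ (proj₂ (proj₂ (proj₂ isB))))))

    φ-path : ∀ v → v ∈ W b → ∃[ ds ] (IsPath v ds (t b) × InSet B ds × walkGain ds ≡ φ b v)
    φ-path = proj₂ (proj₂ (proj₂ (proj₂ (proj₂ (proj₂ (proj₂ isB))))))

    φ-top≡0 : φ b (t b) ≡ 0ℤ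
    φ-top≡0 with φ-path (t b) t∈W
    ... | ds , (p , u) , _ , g≡ with closedPath⇒[] p u
    ... | refl = sym g≡

    0≤φ : ∀ v → v ∈ W b → 0ℤ ≤ φ b v
    0≤φ v v∈ with φ-path v v∈
    ... | ds , p , i , g≡ = subst (0ℤ ≤_) g≡ (t-top v ds v∈ p i)

    φ≤g : ∀ v → v ∈ W b → φ b v ≤ g b
    φ≤g v v∈ with φ-path v v∈
    ... | ds , p , i , g≡ = subst (_≤ g b) g≡ (g-max v (t b) ds v∈ p i)

  start≢end : ∀ d → start d ≢ end d
  start≢end (e , fwd) = All.lookup loopless (∈ₚ.∈-lookup e)
  start≢end (e , bwd) = All.lookup loopless (∈ₚ.∈-lookup e) ∘ sym

  module _ {B : Subset E} (balanced : Balanced B) {b : Block} (isB : IsBlock B b) where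

    end∈W : ∀ d → proj₁ d ∈ₛ B → start d ∈ W b → end d ∈ W b
    end∈W d i s∈ = W-closed isB (start d) (end d) (d ∷ []) s∈
                     (cons refl nil , (start≢end d ∷ []) ∷ [] ∷ []) (i ∷ [])

    -- the two paths to the top vertex close up, through d, to a closed walk of gain 0
    φ-dart : ∀ d → proj₁ d ∈ₛ B → start d ∈ W b → φ b (start d) ≡ dgain d + φ b (end d)
    φ-dart d i s∈ with φ-path isB (start d) s∈ | φ-path isB (end d) (end∈W d i s∈)
    ... | ds , (p , _) , is , gv | es , (q , _) , js , gw =
      subst₂ (λ a c → a ≡ dgain d + c) gv gw (ℤₚ.i-j≡0⇒i≡j (walkGain ds) (dgain d + walkGain es) (begin
        walkGain ds - (dgain d + walkGain es)
          ≡⟨ cong (_+_ (walkGain ds)) (sym (walkGain-reverse (d ∷ es))) ⟩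
        walkGain ds + walkGain back
          ≡⟨ sym (walkGain-++ ds back) ⟩
        walkGain (ds ++ back)
          ≡⟨ closedWalk-gain balanced (ds ++ back) loop inLoop ⟩
        0ℤ ∎))
      where
      open ≡-Reasoning
      back = reverseWalk (d ∷ es)
      loop = IsWalk-++ p (IsWalk-reverse (cons refl q))
      inLoop = InSet-++⁺ ds back is (InSet-reverse (d ∷ es) (i ∷ js))

    φ-walk : ∀ {v w} ds → IsWalk v ds w → InSet B ds → v ∈ W b →
             w ∈ W b × walkGain ds ≡ φ b v - φ b w
    φ-walk {v} []       nil           []       v∈ = v∈ , sym (ℤₚ.+-inverseʳ (φ b v))
    φ-walk {w = w} (d ∷ ds) (cons refl p) (i ∷ is) v∈ with φ-walk ds p is (end∈W d i v∈)
    ... | w∈ , g≡ = w∈ , (begin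
      dgain d + walkGain ds                   ≡⟨ cong (_+_ (dgain d)) g≡ ⟩
      dgain d + (φ b (end d) - φ b w)         ≡⟨ sym (ℤₚ.+-assoc (dgain d) _ _) ⟩
      dgain d + φ b (end d) - φ b w           ≡⟨ cong (_- φ b w) (sym (φ-dart d i v∈)) ⟩
      φ b (start d) - φ b w                   ∎)
      where open ≡-Reasoning

    g≤φ : ∃[ v ] (v ∈ W b × g b ≤ φ b v)
    g≤φ with g-attained isB
    ... | v , w , ds , v∈ , (p , _) , i , g≡ with φ-walk ds p i v∈
    ... | w∈ , gain≡ = v , v∈ , subst (_≤ φ b v) (≡.trans (sym gain≡) g≡)
                                  (subst (φ b v - φ b w ≤_) (ℤₚ.+-identityʳ (φ b v))
                                         (ℤₚ.+-monoʳ-≤ (φ b v) (ℤₚ.neg-mono-≤ (0≤φ isB w w∈))))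

-- Counting the points of the box that solve the blocks

minℤ-≤ : ∀ {x} xs → x ∈ xs → minℤ xs ≤ x
minℤ-≤ (x ∷ [])     (here refl) = ℤₚ.≤-refl
minℤ-≤ (x ∷ y ∷ ys) (here refl) = ℤₚ.i⊓j≤i x (minℤ (y ∷ ys))
minℤ-≤ (x ∷ y ∷ ys) (there x∈)  = ℤₚ.≤-trans (ℤₚ.i⊓j≤j x (minℤ (y ∷ ys))) (minℤ-≤ (y ∷ ys) x∈)

≤-minℤ : ∀ {a} x xs → All (a ≤_) (x ∷ xs) → a ≤ minℤ (x ∷ xs)
≤-minℤ x []       (a≤x ∷ [])  = a≤x
≤-minℤ x (y ∷ ys) (a≤x ∷ a≤s) = ℤₚ.⊓-glb a≤x (≤-minℤ y ys a≤s)

module _ {n : ℕ} where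

  _without_ : List (Fin n) → Fin n → List (Fin n)
  W without t = filter (λ v → ¬? (v Finₚ.≟ t)) W

  t∉-without : ∀ t W → t ∉ W without t
  t∉-without t W t∈ = proj₂ (∈ₚ.∈-filter⁻ (λ v → ¬? (v Finₚ.≟ t)) {xs = W} t∈) refl

  ∈-without⁻ : ∀ t W {v} → v ∈ W without t → v ∈ W × v ≢ t
  ∈-without⁻ t W v∈ = ∈ₚ.∈-filter⁻ (λ v → ¬? (v Finₚ.≟ t)) {xs = W} v∈

  ∈-without⁺ : ∀ t W {v} → v ∈ W → v ≢ t → v ∈ W without t
  ∈-without⁺ t W v∈ v≢t = ∈ₚ.∈-filter⁺ (λ v → ¬? (v Finₚ.≟ t)) v∈ v≢t

  Unique-without : ∀ t W → Unique W → Unique (W without t)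
  Unique-without t W = Uniqueₚ.filter⁺ (λ v → ¬? (v Finₚ.≟ t))

  ↭-without : ∀ t W → Unique W → t ∈ W → W ↭ t ∷ W without t
  ↭-without t (w ∷ W) (w∉ ∷ u) (here refl) =
    prep w (subst (W ↭_) (sym (≡.trans (Listₚ.filter-reject (λ v → ¬? (v Finₚ.≟ t)) (λ ¬≢ → ¬≢ refl))
                                       (Listₚ.filter-all (λ v → ¬? (v Finₚ.≟ t)) (All.map (_∘ sym) w∉))))
                          refl)
  ↭-without t (w ∷ W) (w∉ ∷ u) (there t∈) =
    subst (w ∷ W ↭_) (cong (t ∷_) (sym (Listₚ.filter-accept (λ v → ¬? (v Finₚ.≟ t)) w≢t)))
          (trans (prep w (↭-without t W u t∈)) (swap w t refl))
    where w≢t : w ≢ t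
          w≢t w≡t = All.lookup w∉ t∈ w≡t

module BlockCount {n : ℕ} (A : List (Hyp n)) (loopless : All (λ h → src h ≢ tgt h) A) (m : Vec ℕ n)
  where
  open GainGraph A
  open Walks A
  open BlockPotentials A loopless

  solves? : (y : Vec ℕ n) (b : Block) (v : Fin n) → Dec (coord y v + φ b v ≡ coord y (t b))
  solves? y b v = coord y v + φ b v ℤ.≟ coord y (t b)

  Solves : Vec ℕ n → Block → ℤ
  Solves y b = ∏[ v ∈ W b ] 𝟙 (solves? y b v)

  upper : Block → Fin n → ℤ
  upper b v = coord m v + φ b v

  -- x_t = a forces x_v = a - φ v, which lies in [0, m_v] iff a lies in the window of v
  window : Block → Fin n → ℤ → ℤ
  window b v = inRange (φ b v) (upper b v)

  ceiling : Block → ℤ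
  ceiling b = minℤ (map (upper b) (W b))

  solves?-[]≔ : ∀ y b w v a → v ≢ w → v ≢ t b → 𝟙 (solves? (y [ v ]≔ a) b w) ≡ 𝟙 (solves? y b w)
  solves?-[]≔ y b w v a v≢w v≢t =
    cong₂ (λ p r → 𝟙 (+ p + φ b w ℤ.≟ + r)) (Vecₚ.lookup∘update′ (v≢w ∘ sym) y a)
                                            (Vecₚ.lookup∘update′ (v≢t ∘ sym) y a)

  ∑-range-solves : ∀ y b v → v ≢ t b →
                   ∑[ c ∈ range m v ] 𝟙 (solves? (y [ v ]≔ c) b v) ≡ window b v (coord y (t b))
  ∑-range-solves y b v v≢t = begin
    ∑[ c ∈ range m v ] 𝟙 (solves? (y [ v ]≔ c) b v)
      ≡⟨ ∑-cong (range m v) (λ c → ≡.trans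
           (cong₂ (λ p r → 𝟙 (+ p + φ b v ℤ.≟ + r)) (Vecₚ.lookup∘update v y c)
                                                    (Vecₚ.lookup∘update′ (v≢t ∘ sym) y c))
           (𝟙-⇔ (+ c + φ b v ℤ.≟ T) (+ c ℤ.≟ T - φ b v) (+≡⇒≡- (+ c) (φ b v)) (≡-⇒+≡ (φ b v) T))) ⟩
    ∑[ c ∈ range m v ] 𝟙 (+ c ℤ.≟ T - φ b v)
      ≡⟨ ∑-upTo-≟ (lookup m v) (T - φ b v) ⟩
    inRange 0ℤ (coord m v) (T - φ b v)
      ≡⟨ 𝟙-⇔ (0ℤ ≤? T - φ b v ≤? coord m v) (φ b v ≤? T ≤? upper b v)
             (λ (0≤ , ≤m) → ℤₚ.0≤i-j⇒j≤i 0≤ ,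
                            subst (T ≤_) (ℤₚ.+-comm (φ b v) (coord m v)) (-≤⇒≤-+ (φ b v) ≤m))
             (λ (φ≤ , ≤u) → ℤₚ.i≤j⇒0≤j-i φ≤ ,
                            ≤-+⇒-≤ (φ b v) (subst (T ≤_) (ℤₚ.+-comm (coord m v) (φ b v)) ≤u)) ⟩
    window b v T ∎
    where
    open ≡-Reasoning
    T = coord y (t b)

  sweep-others : ∀ b Rs → Unique Rs → t b ∉ Rs → ∀ y →
                 sweep m Rs (λ z → ∏[ v ∈ Rs ] 𝟙 (solves? z b v)) y ≡ ∏[ v ∈ Rs ] window b v (coord y (t b))
  sweep-others b []       _          _   y = refl
  sweep-others b (v ∷ Rs) (v∉ ∷ uRs) t∉ y = begin
    ∑[ c ∈ range m v ] sweep m Rs (λ z → S z * Srest z) (y [ v ]≔ c)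
      ≡⟨ ∑-cong (range m v) (λ c → sweep-*ˡ m Rs S Srest independent (y [ v ]≔ c)) ⟩
    ∑[ c ∈ range m v ] (S (y [ v ]≔ c) * sweep m Rs Srest (y [ v ]≔ c))
      ≡⟨ ∑-cong (range m v) (λ c → cong (S (y [ v ]≔ c) *_)
           (≡.trans (sweep-others b Rs uRs (t∉ ∘ there) (y [ v ]≔ c))
                    (cong (λ T → ∏[ w ∈ Rs ] window b w (+ T)) (Vecₚ.lookup∘update′ (v≢t ∘ sym) y c)))) ⟩
    ∑[ c ∈ range m v ] (S (y [ v ]≔ c) * rest)
      ≡⟨ ∑-*ʳ (range m v) rest (λ c → S (y [ v ]≔ c)) ⟩
    ∑[ c ∈ range m v ] S (y [ v ]≔ c) * rest
      ≡⟨ cong (_* rest) (∑-range-solves y b v v≢t) ⟩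
    window b v (coord y (t b)) * rest ∎
    where
    open ≡-Reasoning
    S = λ z → 𝟙 (solves? z b v)
    Srest = λ z → ∏[ w ∈ Rs ] 𝟙 (solves? z b w)
    rest = ∏[ w ∈ Rs ] window b w (coord y (t b))
    v≢t : v ≢ t b
    v≢t v≡t = t∉ (here (sym v≡t))
    independent : IndependentOf Rs S
    independent w w∈ z a = solves?-[]≔ z b v w a (λ w≡v → All.lookup v∉ w∈ (sym w≡v))
                                                 (λ w≡t → t∉ (there (subst (_∈ Rs) w≡t w∈)))

  module _ {C : Subset E} (balanced : Balanced C) {b : Block} (isB : IsBlock C b)
           (uniqueW : Unique (W b)) where

    private
      R = W b without t b
      φt≡0 = φ-top≡0 isB

    Solves-others : ∀ y → Solves y b ≡ ∏[ v ∈ R ] 𝟙 (solves? y b v)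
    Solves-others y = begin
      Solves y b
        ≡⟨ ∏-↭ (λ v → 𝟙 (solves? y b v)) (↭-without (t b) (W b) uniqueW (t∈W isB)) ⟩
      𝟙 (solves? y b (t b)) * ∏[ v ∈ R ] 𝟙 (solves? y b v)
        ≡⟨ cong (_* ∏[ v ∈ R ] 𝟙 (solves? y b v)) (𝟙-yes (solves? y b (t b)) solves-top) ⟩
      1ℤ * ∏[ v ∈ R ] 𝟙 (solves? y b v)
        ≡⟨ ℤₚ.*-identityˡ _ ⟩
      ∏[ v ∈ R ] 𝟙 (solves? y b v) ∎
      where
      open ≡-Reasoning
      solves-top = ≡.trans (cong (_+_ (coord y (t b))) φt≡0) (ℤₚ.+-identityʳ _)

    upper-top : upper b (t b) ≡ coord m (t b)
    upper-top = ≡.trans (cong (_+_ (coord m (t b))) φt≡0) (ℤₚ.+-identityʳ _)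

    ∏-window : ∀ a → a ℕ.≤ lookup m (t b) →
               ∏[ v ∈ R ] window b v (+ a) ≡ inRange (g b) (ceiling b) (+ a)
    ∏-window a a≤mt = ≡.trans (∏-𝟙 inWindow? R)
                              (𝟙-⇔ (all? inWindow? R) (g b ≤? + a ≤? ceiling b) to from)
      where
      InWindow = λ v → (φ b v ≤ + a) × (+ a ≤ upper b v)
      inWindow? : ∀ v → Dec (InWindow v)
      inWindow? v = φ b v ≤? + a ≤? upper b v
      to : All InWindow R → (g b ≤ + a) × (+ a ≤ ceiling b)
      to inside = g≤a , ≤-minℤ-W (All.tabulate a≤)
        where
        g≤a : g b ≤ + a
        g≤a with g≤φ balanced isB
        ... | v , v∈ , g≤φv with v Finₚ.≟ t b
        ...   | yes refl = ℤₚ.≤-trans g≤φv (subst (_≤ + a) (sym φt≡0) (+≤+ z≤n))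
        ...   | no v≢t   = ℤₚ.≤-trans g≤φv (proj₁ (All.lookup inside (∈-without⁺ (t b) (W b) v∈ v≢t)))
        a≤ : ∀ {v} → v ∈ W b → + a ≤ upper b v
        a≤ {v} v∈ with v Finₚ.≟ t b
        ... | yes refl = subst (+ a ≤_) (sym upper-top) (+≤+ a≤mt)
        ... | no v≢t   = proj₂ (All.lookup inside (∈-without⁺ (t b) (W b) v∈ v≢t))
        ≤-minℤ-W : All (λ v → + a ≤ upper b v) (W b) → + a ≤ ceiling b
        ≤-minℤ-W with W b | W-nonEmpty isB
        ... | w ∷ ws | nonEmpty = λ al → ≤-minℤ _ _ (Allₚ.map⁺ al)
      from : (g b ≤ + a) × (+ a ≤ ceiling b) → All InWindow R
      from (g≤a , a≤ceiling) = All.tabulate λ {v} v∈ →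
        let v∈W = proj₁ (∈-without⁻ (t b) (W b) v∈) in
        ℤₚ.≤-trans (φ≤g isB v v∈W) g≤a ,
        ℤₚ.≤-trans a≤ceiling (minℤ-≤ (map (upper b) (W b)) (∈ₚ.∈-map⁺ (upper b) v∈W))

    sweep-block : ∀ x → sweep m (t b ∷ R) (λ y → Solves y b) x ≡ blockFactor m b
    sweep-block x = begin
      ∑[ a ∈ U ] sweep m R (λ y → Solves y b) (x [ t b ]≔ a)
        ≡⟨ ∑-cong U (λ a → sweep-cong m R Solves-others (x [ t b ]≔ a)) ⟩
      ∑[ a ∈ U ] sweep m R (λ y → ∏[ v ∈ R ] 𝟙 (solves? y b v)) (x [ t b ]≔ a)
        ≡⟨ ∑-cong U (λ a → sweep-others b R (Unique-without (t b) (W b) uniqueW)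
                                            (t∉-without (t b) (W b)) (x [ t b ]≔ a)) ⟩
      ∑[ a ∈ U ] ∏[ v ∈ R ] window b v (coord (x [ t b ]≔ a) (t b))
        ≡⟨ ∑-cong U (λ a → cong (λ T → ∏[ v ∈ R ] window b v (+ T)) (Vecₚ.lookup∘update (t b) x a)) ⟩
      ∑[ a ∈ U ] ∏[ v ∈ R ] window b v (+ a)
        ≡⟨ ∑-cong-∈ U (λ a a∈ → ∏-window a (ℕ.s≤s⁻¹ (∈ₚ.∈-upTo⁻ a∈))) ⟩
      ∑[ a ∈ U ] inRange (g b) (ceiling b) (+ a)
        ≡⟨ ∑-upTo-inRange (suc (lookup m (t b))) (g b) (ceiling b) 0≤g ceiling<1+mt ⟩
      blockFactor m b ∎
      where
      open ≡-Reasoning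
      U = range m (t b)
      0≤g : 0ℤ ≤ g b
      0≤g = subst (_≤ g b) φt≡0 (φ≤g isB (t b) (t∈W isB))
      ceiling<1+mt : ceiling b ℤ.< + suc (lookup m (t b))
      ceiling<1+mt = ℤₚ.≤-<-trans (subst (ceiling b ≤_) upper-top (minℤ-≤ (map (upper b) (W b))
                                                                  (∈ₚ.∈-map⁺ (upper b) (t∈W isB))))
                                  (+<+ (ℕₚ.n<1+n _))

  sweepOrder : List Block → List (Fin n)
  sweepOrder bs = concat (map (λ b → t b ∷ W b without t b) bs)

  sweepOrder↭ : ∀ {C} bs → All (IsBlock C) bs → Unique (concat (map W bs)) →
                sweepOrder bs ↭ concat (map W bs)
  sweepOrder↭ []       []         _ = refl
  sweepOrder↭ (b ∷ bs) (isB ∷ al) u = ↭ₚ.++⁺ (↭-sym (↭-without (t b) (W b) (proj₁ split) (t∈W isB)))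
                                             (sweepOrder↭ bs al (proj₁ (proj₂ split)))
    where split = Unique-++⁻ (W b) (concat (map W bs)) u

  sweep-blocks : ∀ {C} → Balanced C → ∀ bs → All (IsBlock C) bs → Unique (concat (map W bs)) → ∀ x →
                 sweep m (sweepOrder bs) (λ y → ∏[ b ∈ bs ] Solves y b) x ≡ ∏ bs (blockFactor m)
  sweep-blocks balanced []       []         _ x = refl
  sweep-blocks balanced (b ∷ bs) (isB ∷ al) u x = begin
    sweep m (T ++ sweepOrder bs) (λ y → S y * Srest y) x
      ≡⟨ sweep-++ m T (sweepOrder bs) _ x ⟩
    sweep m T (sweep m (sweepOrder bs) (λ y → S y * Srest y)) x
      ≡⟨ sweep-cong m T (λ y → ≡.trans (sweep-*ˡ m (sweepOrder bs) S Srest independent y)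
                                       (cong (S y *_) (sweep-blocks balanced bs al uniqueRest y))) x ⟩
    sweep m T (λ y → S y * rest) x
      ≡⟨ sweep-*ʳ m T S rest x ⟩
    sweep m T S x * rest
      ≡⟨ cong (_* rest) (sweep-block balanced isB (proj₁ split) x) ⟩
    blockFactor m b * rest ∎
    where
    open ≡-Reasoning
    T = t b ∷ W b without t b
    S = λ y → Solves y b
    Srest = λ y → ∏[ b′ ∈ bs ] Solves y b′
    rest = ∏ bs (blockFactor m)
    split = Unique-++⁻ (W b) (concat (map W bs)) u
    uniqueRest = proj₁ (proj₂ split)
    outside : ∀ {v} → v ∈ sweepOrder bs → ∀ {w} → w ∈ W b → v ≢ w
    outside v∈ w∈ refl = proj₂ (proj₂ split) w∈ (↭ₚ.∈-resp-↭ (sweepOrder↭ bs al uniqueRest) v∈)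
    independent : IndependentOf (sweepOrder bs) S
    independent v v∈ y a =
      ∏-cong-∈ (W b) (λ w w∈ → solves?-[]≔ y b w v a (outside v∈ w∈) (outside v∈ (t∈W isB)))

  ∏-width≡+suc : ∀ vs → ∃[ k ] (∏ vs (width m) ≡ + suc k)
  ∏-width≡+suc []       = 0 , refl
  ∏-width≡+suc (v ∷ vs) with ∏-width≡+suc vs
  ... | k , ∏≡ = k ℕ.+ lookup m v ℕ.* suc k , cong (width m v *_) ∏≡

  -- Sweeping every coordinate once, block by block, multiplies the box sum by the box size
  -- while collapsing the integrand to the constant product of the block factors.
  ∑-box-Solves : ∀ {C} → Balanced C → ∀ bs → IsPartitionData C bs →
                 ∑[ x ∈ box m ] ∏[ b ∈ bs ] Solves x b ≡ ∏ bs (blockFactor m)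
  ∑-box-Solves balanced bs (perm , al) with ∏-width≡+suc (allFin n)
  ... | k , ∏≡ = ℤₚ.*-cancelˡ-≡ (+ suc k) _ _ (begin
    + suc k * ∑ (box m) F
      ≡⟨ cong (_* ∑ (box m) F) (≡.trans (sym ∏≡) (sym (∏-↭ (width m) order↭))) ⟩
    ∏ (sweepOrder bs) (width m) * ∑ (box m) F
      ≡⟨ sym (∑-box-sweep m (sweepOrder bs) F) ⟩
    ∑ (box m) (sweep m (sweepOrder bs) F)
      ≡⟨ ∑-cong (box m) (sweep-blocks balanced bs al uniqueW) ⟩
    ∑[ _ ∈ box m ] P
      ≡⟨ ∑-const (box m) P ⟩
    + length (box m) * P
      ≡⟨ cong (_* P) (≡.trans (length-box m) ∏≡) ⟩
    + suc k * P ∎)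
    where
    open ≡-Reasoning
    F = λ x → ∏[ b ∈ bs ] Solves x b
    P = ∏ bs (blockFactor m)
    uniqueW : Unique (concat (map W bs))
    uniqueW = Setoid↭ₚ.Unique-resp-↭ (setoid (Fin n)) (↭⇒↭ₛ (↭-sym perm)) (Uniqueₚ.allFin⁺ n)
    order↭ : sweepOrder bs ↭ allFin n
    order↭ = trans (sweepOrder↭ bs al uniqueW) perm

  𝟙-⊆satisfied : ∀ {C} → Balanced C → ∀ bs → IsPartitionData C bs → ∀ x →
                 𝟙 (C ⊆? Satisfied.satisfied A x) ≡ ∏[ b ∈ bs ] Solves x b
  𝟙-⊆satisfied {C} balanced bs (perm , al) x = sym (begin
    ∏[ b ∈ bs ] Solves x b
      ≡⟨ ∏-cong bs (λ b → ∏-𝟙 (solves? x b) (W b)) ⟩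
    ∏[ b ∈ bs ] 𝟙 (all? (solves? x b) (W b))
      ≡⟨ ∏-𝟙 (λ b → all? (solves? x b) (W b)) bs ⟩
    𝟙 (all? (λ b → all? (solves? x b) (W b)) bs)
      ≡⟨ 𝟙-⇔ _ (C ⊆? satisfied) from to ⟩
    𝟙 (C ⊆? satisfied) ∎)
    where
    open ≡-Reasoning
    open Satisfied A x
    Solved = λ b v → coord x v + φ b v ≡ coord x (t b)
    to : C ⊆ satisfied → All (λ b → All (Solved b) (W b)) bs
    to C⊆ = All.tabulate λ {b} b∈ → All.tabulate λ {v} v∈ →
      let ds , (p , _) , i , g≡ = φ-path (All.lookup al b∈) v v∈
      in ≡.trans (ℤₚ.+-comm (coord x v) (φ b v))
                 (≡-⇒+≡ (coord x v) (coord x (t b))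
                        (≡.trans (sym g≡) (walkGain-satisfied ds p (All.map C⊆ i))))
    from : All (λ b → All (Solved b) (W b)) bs → C ⊆ satisfied
    from solved {e} e∈C
      with ∈ₚ.∈-concat⁻′ (map W bs) (↭ₚ.∈-resp-↭ (↭-sym perm) (∈ₚ.∈-allFin (src (edge e))))
    ... | _ , v∈ , Wb∈ with ∈ₚ.∈-map⁻ W Wb∈
    ... | b , b∈ , refl = ⇒∈satisfied e (+-cancelʳ (coord x w) (coord x v + gain (edge e)) (φ b w) (begin
      coord x w + φ b w                    ≡⟨ All.lookup (All.lookup solved b∈) w∈ ⟩
      coord x (t b)                        ≡⟨ sym (All.lookup (All.lookup solved b∈) v∈) ⟩
      coord x v + φ b v                    ≡⟨ cong (_+_ (coord x v)) (φ-dart balanced isB (e , fwd) e∈C v∈) ⟩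
      coord x v + (gain (edge e) + φ b w)  ≡⟨ sym (ℤₚ.+-assoc (coord x v) (gain (edge e)) (φ b w)) ⟩
      coord x v + gain (edge e) + φ b w    ∎))
      where
      v = src (edge e)
      w = tgt (edge e)
      isB = All.lookup al b∈
      w∈ = end∈W balanced isB (e , fwd) e∈C v∈

-- Möbius inversion over the closed balanced sets

∑-unique-support : {X : Set} {a : X} (xs : List X) (f : X → ℤ) → Unique xs → a ∈ xs →
                   (∀ x → x ∈ xs → x ≢ a → f x ≡ 0ℤ) → ∑ xs f ≡ f a
∑-unique-support (x ∷ xs) f u (here refl) vanish = begin
  f x + ∑ xs f          ≡⟨ cong (_+_ (f x))
                                (∑-cong-∈ xs (λ y y∈ → vanish y (there y∈) (Unique-head-≢ u y∈ ∘ sym))) ⟩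
  f x + ∑[ _ ∈ xs ] 0ℤ  ≡⟨ cong (_+_ (f x)) (∑-zero xs) ⟩
  f x + 0ℤ              ≡⟨ ℤₚ.+-identityʳ (f x) ⟩
  f x                   ∎
  where open ≡-Reasoning
∑-unique-support (x ∷ xs) f u (there a∈) vanish = begin
  f x + ∑ xs f          ≡⟨ cong₂ _+_ (vanish x (here refl) (Unique-head-≢ u a∈))
                                     (∑-unique-support xs f (Unique-tail u) a∈ (λ y → vanish y ∘ there)) ⟩
  0ℤ + f _              ≡⟨ ℤₚ.+-identityˡ _ ⟩
  f _                   ∎
  where open ≡-Reasoning

∑-μ-⊆⊥ : ∀ {k} (μ : Subset k → ℤ) (L : List (Subset k)) → Unique L → ⊥ ∈ L →
         ∑[ C ∈ L ] (if ⌊ C ⊆? ⊥ ⌋ then μ C else 0ℤ) ≡ μ ⊥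
∑-μ-⊆⊥ μ L uniqueL ⊥∈L = begin
  ∑[ C ∈ L ] (if ⌊ C ⊆? ⊥ ⌋ then μ C else 0ℤ)   ≡⟨ ∑-unique-support L _ uniqueL ⊥∈L vanish ⟩
  (if ⌊ ⊥ ⊆? ⊥ ⌋ then μ ⊥ else 0ℤ)             ≡⟨ if-then-0≡*𝟙 (⊥ ⊆? ⊥) (μ ⊥) ⟩
  μ ⊥ * 𝟙 (⊥ ⊆? ⊥)                             ≡⟨ cong (μ ⊥ *_) (𝟙-yes (⊥ ⊆? ⊥) (λ x∈ → x∈)) ⟩
  μ ⊥ * 1ℤ                                     ≡⟨ ℤₚ.*-identityʳ (μ ⊥) ⟩
  μ ⊥                                          ∎
  where
  open ≡-Reasoning
  vanish : ∀ C → C ∈ L → C ≢ ⊥ → (if ⌊ C ⊆? ⊥ ⌋ then μ C else 0ℤ) ≡ 0ℤ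
  vanish C _ C≢⊥ = ≡.trans (if-then-0≡*𝟙 (C ⊆? ⊥) (μ C))
                           (≡.trans (cong (μ C *_) (𝟙-no (C ⊆? ⊥) (C≢⊥ ∘ ⊆⊥⇒≡⊥))) (ℤₚ.*-zeroʳ (μ C)))
    where ⊆⊥⇒≡⊥ = λ C⊆⊥ → Subsetₚ.Empty-unique (λ (e , e∈) → Subsetₚ.∉⊥ (C⊆⊥ e∈))

module InclusionExclusion {n : ℕ} (A : List (Hyp n))
  {L : List (Subset (length A))} (uniqueL : Unique L)
  (L-closedBalanced : ∀ B → (B ∈ L) ⇔ (GainGraph.Balanced A B × GainGraph.Closed A B))
  (μ : Subset (length A) → ℤ) (μ⊥ : μ ⊥ ≡ 1ℤ)
  (mobius : ∀ B → B ∈ L → B ≢ ⊥ → ∑[ C ∈ L ] (if ⌊ C ⊆? B ⌋ then μ C else 0ℤ) ≡ 0ℤ)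
  where

  𝟙-avoids : ∀ x → 𝟙 (all? (λ h → ¬? (Satisfied.satisfies? A x h)) A)
                 ≡ ∑[ C ∈ L ] (μ C * 𝟙 (C ⊆? Satisfied.satisfied A x))
  𝟙-avoids x = ≡.trans (byCases (all? (λ h → ¬? (satisfies? h)) A))
                       (∑-cong L (λ C → if-then-0≡*𝟙 (C ⊆? satisfied) (μ C)))
    where
    open Satisfied A x
    satisfied∈L : satisfied ∈ L
    satisfied∈L = Equivalence.from (L-closedBalanced satisfied) (satisfied-balanced , satisfied-closed)
    byCases : (d : Dec (Avoids A x)) → 𝟙 d ≡ ∑[ C ∈ L ] (if ⌊ C ⊆? satisfied ⌋ then μ C else 0ℤ)
    byCases (yes avoids) = sym (begin
      ∑[ C ∈ L ] (if ⌊ C ⊆? satisfied ⌋ then μ C else 0ℤ)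
        ≡⟨ cong (λ S → ∑[ C ∈ L ] (if ⌊ C ⊆? S ⌋ then μ C else 0ℤ)) S≡⊥ ⟩
      ∑[ C ∈ L ] (if ⌊ C ⊆? ⊥ ⌋ then μ C else 0ℤ)
        ≡⟨ ∑-μ-⊆⊥ μ L uniqueL (subst (_∈ L) S≡⊥ satisfied∈L) ⟩
      μ ⊥
        ≡⟨ μ⊥ ⟩
      1ℤ ∎)
      where
      open ≡-Reasoning
      S≡⊥ = avoids⇒satisfied≡⊥ avoids
    byCases (no ¬avoids) = sym (mobius satisfied satisfied∈L (¬avoids ∘ satisfied≡⊥⇒avoids))

theorem5p19 : (n : ℕ) (m : Vec ℕ n) (A : List (Hyp n))
    → All (λ h → src h ≢ tgt h) A
    → AllPairs (λ h h' → ¬ SameHyperplane h h') A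
    → (L : List (Subset (length A)))
    → Unique L
    → (∀ B → (B ∈ L) ⇔ (GainGraph.Balanced A B × GainGraph.Closed A B))
    → (μ : Subset (length A) → ℤ)
    → μ ⊥ ≡ 1ℤ
    → (∀ B → B ∈ L → B ≢ ⊥ → sumℤ (map (λ C → if ⌊ C ⊆? B ⌋ then μ C else 0ℤ) L) ≡ 0ℤ)
    → (blocks : Subset (length A) → List (GainGraph.Block A))
    → (∀ B → B ∈ L → GainGraph.IsPartitionData A B (blocks B))
    → + countPoints m A ≡ sumℤ (map (λ B → μ B * prodℤ (map (blockFactor m) (blocks B))) L)
theorem5p19 n m A loopless _ L uniqueL L-closedBalanced μ μ⊥ mobius blocks partition = begin
  + countPoints m A
    ≡⟨ length-filter avoids? (box m) ⟩
  ∑[ x ∈ box m ] 𝟙 (avoids? x)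
    ≡⟨ ∑-cong (box m) (𝟙-avoids uniqueL L-closedBalanced μ μ⊥ mobius) ⟩
  ∑[ x ∈ box m ] ∑[ C ∈ L ] (μ C * 𝟙 (C ⊆? S x))
    ≡⟨ ∑-swap (box m) L (λ x C → μ C * 𝟙 (C ⊆? S x)) ⟩
  ∑[ C ∈ L ] ∑[ x ∈ box m ] (μ C * 𝟙 (C ⊆? S x))
    ≡⟨ ∑-cong-∈ L (λ C C∈ → ≡.trans (∑-*ˡ (box m) (μ C) (λ x → 𝟙 (C ⊆? S x)))
                                    (cong (μ C *_) (count C C∈))) ⟩
  ∑[ C ∈ L ] (μ C * ∏ (blocks C) (blockFactor m)) ∎
  where
  open ≡-Reasoning
  open InclusionExclusion A using (𝟙-avoids)
  open BlockCount A loopless m using (∑-box-Solves; 𝟙-⊆satisfied)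
  S = Satisfied.satisfied A
  avoids? = λ x → all? (λ h → ¬? (Satisfied.satisfies? A x h)) A
  count : ∀ C → C ∈ L → ∑[ x ∈ box m ] 𝟙 (C ⊆? S x) ≡ ∏ (blocks C) (blockFactor m)
  count C C∈ = ≡.trans (∑-cong (box m) (𝟙-⊆satisfied balanced (blocks C) (partition C C∈)))
                       (∑-box-Solves balanced (blocks C) (partition C C∈))
    where balanced = proj₁ (Equivalence.to (L-closedBalanced C) C∈)
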